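{- Let $n$ be a positive integer. Then \[G(n,x)=\prod_{i=1}^{n}(1+x^i)^{c_{n,i}},\qquad c_{n,i}=\Big\lfloor\frac{n}{i}\Big\rfloor-\Big\lfloor\log_2\Big(\frac{n}{i}\Big)\Big\rfloor-1,\] and moreover $c_{n,i}>0$ for $i=1,\dots,\lfloor n/3\rfloor$ and the sequence $(c_{n,1},c_{n,2},\dots,c_{n,n})$ is weakly decreasing.
   Context: For a partition $\lambda\vdash n$ let $m_\lambda(i)$ be the number of parts equal to $i$, let $h_\lambda(x)=\prod_{i\geq 1}(1+x^i)^{\lfloor n/i\rfloor-m_\lambda(i)}$, and let $G(n,x)=\gcd\{h_\lambda(x)\mid\lambda\vdash n\}$ (monic gcd in $\mathbb{Z}[x]$). -}

module Defs where

open import Data.Bool using (Bool; true; false; if_then_else_)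
open import Data.Nat as ℕ using (ℕ; zero; suc; _∸_; _≤_; _<_; _≤ᵇ_; _≡ᵇ_)
open import Data.Nat.DivMod using (_/_)
open import Data.Nat.ListAction using (sum)
open import Data.Integer as ℤ using (ℤ; +_)
open import Data.List using (List; []; _∷_; map; upTo; foldr; replicate; _++_; filterᵇ; length)
open import Data.List.Relation.Unary.All using (All)
open import Data.List.Relation.Unary.Linked using (Linked)
open import Data.Product using (Σ; _×_; ∃)
open import Relation.Binary.PropositionalEquality using (_≡_)

-- Polynomials in ℤ[x] as coefficient lists (constant term first).
-- Trailing zeros are allowed; equality is coefficientwise.

Poly : Set
Poly = List ℤ

coeff : Poly → ℕ → ℤ
coeff []       _       = + 0
coeff (a ∷ f)  zero    = a
coeff (a ∷ f)  (suc k) = coeff f k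

_≈ₚ_ : Poly → Poly → Set
f ≈ₚ g = ∀ k → coeff f k ≡ coeff g k

_+ₚ_ : Poly → Poly → Poly
[]      +ₚ g       = g
(a ∷ f) +ₚ []      = a ∷ f
(a ∷ f) +ₚ (b ∷ g) = (a ℤ.+ b) ∷ (f +ₚ g)

scaleₚ : ℤ → Poly → Poly
scaleₚ a = map (a ℤ.*_)

_*ₚ_ : Poly → Poly → Poly
[]      *ₚ g = []
(a ∷ f) *ₚ g = scaleₚ a g +ₚ (+ 0 ∷ (f *ₚ g))

oneₚ : Poly
oneₚ = + 1 ∷ []

xpow : ℕ → Poly
xpow i = replicate i (+ 0) ++ (+ 1 ∷ [])

_^ₚ_ : Poly → ℕ → Poly
f ^ₚ zero  = oneₚ
f ^ₚ suc k = f *ₚ (f ^ₚ k)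

prodₚ : List Poly → Poly
prodₚ = foldr _*ₚ_ oneₚ

onePlusX : ℕ → Poly
onePlusX i = oneₚ +ₚ xpow i

_∣ₚ_ : Poly → Poly → Set
d ∣ₚ f = Σ Poly (λ q → (d *ₚ q) ≈ₚ f)

Monic : Poly → Set
Monic f = Σ ℕ (λ d → (coeff f d ≡ + 1) × (∀ k → d < k → coeff f k ≡ + 0))

IsMonicGCD : {A : Set} → (A → Set) → (A → Poly) → Poly → Set
IsMonicGCD {A} P F g =
  Monic g
  × (∀ a → P a → g ∣ₚ F a)
  × (∀ e → (∀ a → P a → e ∣ₚ F a) → e ∣ₚ g)

IsPartition : ℕ → List ℕ → Set
IsPartition n λs = Linked ℕ._≥_ λs × All (0 <_) λs × sum λs ≡ n

mult : List ℕ → ℕ → ℕ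
mult λs i = length (filterᵇ (_≡ᵇ i) λs)

oneTo : ℕ → List ℕ
oneTo n = map suc (upTo n)

-- ⌊n / i⌋ with the convention ⌊n/0⌋ = 0 (never used at i = 0)
divℕ : ℕ → ℕ → ℕ
divℕ n zero    = 0
divℕ n (suc j) = n / suc j

-- h_λ(x) = ∏_{i ≥ 1} (1+x^i)^{⌊n/i⌋ - m_λ(i)}; factors with i > n equal 1.
h : ℕ → List ℕ → Poly
h n λs = prodₚ (map (λ i → onePlusX i ^ₚ (divℕ n i ∸ mult λs i)) (oneTo n))

-- ⌊log₂(n/i)⌋ for 1 ≤ i ≤ n: the largest k with i·2^k ≤ n
-- (search with fuel n, which suffices since such k < n).
flog2 : ℕ → ℕ → ℕ
flog2 n i = go n 0
  where
  go : ℕ → ℕ → ℕ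
  go zero    k = k
  go (suc f) k = if (i ℕ.* 2 ℕ.^ suc k) ≤ᵇ n then go f (suc k) else k

-- c_{n,i} = ⌊n/i⌋ - ⌊log₂(n/i)⌋ - 1   (nonnegative for 1 ≤ i ≤ n)
c : ℕ → ℕ → ℕ
c n i = divℕ n i ∸ flog2 n i ∸ 1

Gformula : ℕ → Poly
Gformula n = prodₚ (map (λ i → onePlusX i ^ₚ c n i) (oneTo n))

{-# OPTIONS --safe #-}
module Submission where

-- Over ℚ, 1 + xⁱ = (1 - x²ⁱ) / (1 - xⁱ) is the product of the cyclotomic polynomials Φ e with
-- e ∣ 2i and e ∤ i, i.e. e = 2d with i/d odd. So G and every h_λ are products of powers of the
-- pairwise coprime Φ e, and the gcd is computed exponent by exponent. The exponent of Φ (2d) in h_λ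
-- is ∑ᵢ ⌊n/i⌋ [i/d odd] minus the number of parts of λ that are odd multiples of d; that number is
-- at most ⌊n/d⌋, with equality for λ = d^⌊n/d⌋ 1^(n mod d). As ⌊log₂(n/i)⌋ + 1 counts the k with
-- i·2ᵏ ≤ n, and every multiple of d up to n is uniquely such an i·2ᵏ with i/d odd, the exponent of
-- Φ (2d) in G is exactly this minimum ∑ᵢ ⌊n/i⌋ [i/d odd] - ⌊n/d⌋.
--
-- The Φ e are built by induction as exact quotients in ℤ[x] and are coprime only over ℚ; but every
-- common divisor of the h_λ has constant term ±1, and dividing by such a polynomial stays in ℤ[x].
--
-- Finally c n i = q - ⌊log₂ q⌋ - 1 for q = ⌊n/i⌋, which is nondecreasing in q and positive for q ≥ 3.

open import Defs

open import Algebra.Bundles using (CommutativeSemigroup; CommutativeRing)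
import Algebra.Properties.CommutativeSemigroup as CommutativeSemigroupProperties
open import Data.Bool using (true; false; if_then_else_)
open import Data.Empty using (⊥-elim)
open import Data.Integer as ℤ using (ℤ; +_; +0)
import Data.Integer.Properties as ℤ
import Data.Integer.Tactic.RingSolver as ℤ-Solver
open import Data.List using (List; []; _∷_; map; replicate; _++_; upTo)
import Data.List.Properties as List
open import Data.List.Relation.Unary.All as All using (All)
import Data.List.Relation.Unary.All.Properties as All
open import Data.List.Relation.Unary.Linked as Linked using (Linked)
open import Data.Maybe using (Maybe; just; nothing)
open import Data.Nat as ℕ using (ℕ; zero; suc; _≤_; _<_)
import Data.Nat.DivMod as ℕ
import Data.Nat.Divisibility as ℕ
open import Data.Nat.GCD using (module Bézout; module GCD)
open import Data.Nat.Induction using (<-rec)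
open import Data.Nat.ListAction using (sum)
import Data.Nat.ListAction.Properties as ℕ
import Data.Nat.Properties as ℕ
import Data.Nat.Tactic.RingSolver as ℕ-Solver
open import Data.Product using (Σ; _,_; _×_; ∃-syntax; proj₁; proj₂)
open import Data.Sum using (_⊎_; inj₁; inj₂)
open import Function using (_∘_)
open import Level using (0ℓ)
open import Relation.Binary.Bundles using (Setoid)
open import Relation.Binary.PropositionalEquality
  using (_≡_; _≢_; refl; sym; trans; cong; cong₂; subst; subst₂; module ≡-Reasoning)
import Relation.Binary.Reasoning.Setoid as SetoidReasoning
open import Relation.Nullary using (¬_; yes; no)
open import Relation.Nullary.Reflects using (ofʸ; ofⁿ)
open import Tactic.RingSolver using (solve; solve-∀)
import Tactic.RingSolver.Core.AlmostCommutativeRing as ACR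

-- The ring ℤ[x]

-- A record rather than _≈ₚ_ itself, so that f and g can be inferred from f ≋ g.
infix 4 _≋_
record _≋_ (f g : Poly) : Set where
  constructor mk≋
  field at : f ≈ₚ g
open _≋_ public

≋-refl : ∀ {f} → f ≋ f
≋-refl = mk≋ λ _ → refl

≋-sym : ∀ {f g} → f ≋ g → g ≋ f
≋-sym f≋g = mk≋ λ k → sym (at f≋g k)

≋-trans : ∀ {f g h} → f ≋ g → g ≋ h → f ≋ h
≋-trans f≋g g≋h = mk≋ λ k → trans (at f≋g k) (at g≋h k)

≋-setoid : Setoid 0ℓ 0ℓ
≋-setoid = record { _≈_ = _≋_ ; isEquivalence = record { refl = ≋-refl ; sym = ≋-sym ; trans = ≋-trans } }

module ≋-Reasoning = SetoidReasoning ≋-setoid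

≡⇒≋ : ∀ {f g} → f ≡ g → f ≋ g
≡⇒≋ refl = ≋-refl

shift : Poly → Poly
shift f = + 0 ∷ f

negₚ : Poly → Poly
negₚ = scaleₚ ℤ.-1ℤ

coeff-+ₚ : ∀ f g k → coeff (f +ₚ g) k ≡ coeff f k ℤ.+ coeff g k
coeff-+ₚ []      g       k       = sym (ℤ.+-identityˡ _)
coeff-+ₚ (a ∷ f) []      k       = sym (ℤ.+-identityʳ _)
coeff-+ₚ (a ∷ f) (b ∷ g) zero    = refl
coeff-+ₚ (a ∷ f) (b ∷ g) (suc k) = coeff-+ₚ f g k

coeff-scaleₚ : ∀ a f k → coeff (scaleₚ a f) k ≡ a ℤ.* coeff f k
coeff-scaleₚ a []      k       = sym (ℤ.*-zeroʳ a)
coeff-scaleₚ a (b ∷ f) zero    = refl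
coeff-scaleₚ a (b ∷ f) (suc k) = coeff-scaleₚ a f k

coeff-∷-*ₚ : ∀ a f g k → coeff ((a ∷ f) *ₚ g) k ≡ a ℤ.* coeff g k ℤ.+ coeff (shift (f *ₚ g)) k
coeff-∷-*ₚ a f g k = trans (coeff-+ₚ (scaleₚ a g) _ k) (cong (ℤ._+ _) (coeff-scaleₚ a g k))

∷-cong : ∀ {a b f g} → a ≡ b → f ≋ g → (a ∷ f) ≋ (b ∷ g)
∷-cong a≡b f≋g = mk≋ λ { zero → a≡b ; (suc k) → at f≋g k }

shift-cong : ∀ {f g} → f ≋ g → shift f ≋ shift g
shift-cong = ∷-cong refl

shift-[] : shift [] ≋ []
shift-[] = mk≋ λ { zero → refl ; (suc k) → refl }

+ₚ-cong : ∀ {f f′ g g′} → f ≋ f′ → g ≋ g′ → (f +ₚ g) ≋ (f′ +ₚ g′)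
+ₚ-cong {f} {f′} {g} {g′} f≋f′ g≋g′ = mk≋ λ k → begin
  coeff (f +ₚ g) k            ≡⟨ coeff-+ₚ f g k ⟩
  coeff f k ℤ.+ coeff g k     ≡⟨ cong₂ ℤ._+_ (at f≋f′ k) (at g≋g′ k) ⟩
  coeff f′ k ℤ.+ coeff g′ k   ≡⟨ coeff-+ₚ f′ g′ k ⟨
  coeff (f′ +ₚ g′) k          ∎
  where open ≡-Reasoning

+ₚ-identityʳ : ∀ f → (f +ₚ []) ≋ f
+ₚ-identityʳ f = mk≋ λ k → trans (coeff-+ₚ f [] k) (ℤ.+-identityʳ _)

+ₚ-comm : ∀ f g → (f +ₚ g) ≋ (g +ₚ f)
+ₚ-comm f g = mk≋ λ k → begin
  coeff (f +ₚ g) k          ≡⟨ coeff-+ₚ f g k ⟩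
  coeff f k ℤ.+ coeff g k   ≡⟨ ℤ.+-comm (coeff f k) _ ⟩
  coeff g k ℤ.+ coeff f k   ≡⟨ coeff-+ₚ g f k ⟨
  coeff (g +ₚ f) k          ∎
  where open ≡-Reasoning

+ₚ-assoc : ∀ f g h → ((f +ₚ g) +ₚ h) ≋ (f +ₚ (g +ₚ h))
+ₚ-assoc f g h = mk≋ λ k → begin
  coeff ((f +ₚ g) +ₚ h) k                    ≡⟨ coeff-+ₚ (f +ₚ g) h k ⟩
  coeff (f +ₚ g) k ℤ.+ coeff h k             ≡⟨ cong (ℤ._+ coeff h k) (coeff-+ₚ f g k) ⟩
  coeff f k ℤ.+ coeff g k ℤ.+ coeff h k      ≡⟨ ℤ.+-assoc (coeff f k) _ _ ⟩
  coeff f k ℤ.+ (coeff g k ℤ.+ coeff h k)    ≡⟨ cong (ℤ._+_ (coeff f k)) (coeff-+ₚ g h k) ⟨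
  coeff f k ℤ.+ coeff (g +ₚ h) k             ≡⟨ coeff-+ₚ f (g +ₚ h) k ⟨
  coeff (f +ₚ (g +ₚ h)) k                    ∎
  where open ≡-Reasoning

+ₚ-commutativeSemigroup : CommutativeSemigroup 0ℓ 0ℓ
+ₚ-commutativeSemigroup = record
  { _≈_ = _≋_ ; _∙_ = _+ₚ_
  ; isCommutativeSemigroup = record
    { isSemigroup = record
      { isMagma = record { isEquivalence = Setoid.isEquivalence ≋-setoid ; ∙-cong = +ₚ-cong }
      ; assoc = +ₚ-assoc }
    ; comm = +ₚ-comm } }

open CommutativeSemigroupProperties +ₚ-commutativeSemigroup
  using () renaming (interchange to +ₚ-interchange; x∙yz≈y∙xz to +ₚ-left-comm)

scaleₚ-cong : ∀ a {f g} → f ≋ g → scaleₚ a f ≋ scaleₚ a g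
scaleₚ-cong a {f} {g} f≋g = mk≋ λ k → begin
  coeff (scaleₚ a f) k   ≡⟨ coeff-scaleₚ a f k ⟩
  a ℤ.* coeff f k        ≡⟨ cong (a ℤ.*_) (at f≋g k) ⟩
  a ℤ.* coeff g k        ≡⟨ coeff-scaleₚ a g k ⟨
  coeff (scaleₚ a g) k   ∎
  where open ≡-Reasoning

scaleₚ-zero : ∀ f → scaleₚ +0 f ≋ []
scaleₚ-zero f = mk≋ λ k → trans (coeff-scaleₚ +0 f k) (ℤ.*-zeroˡ (coeff f k))

scaleₚ-identity : ∀ f → scaleₚ (+ 1) f ≋ f
scaleₚ-identity f = mk≋ λ k → trans (coeff-scaleₚ (+ 1) f k) (ℤ.*-identityˡ (coeff f k))

scaleₚ-shift : ∀ a f → scaleₚ a (shift f) ≋ shift (scaleₚ a f)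
scaleₚ-shift a f = ∷-cong (ℤ.*-zeroʳ a) ≋-refl

scaleₚ-distribˡ : ∀ a f g → scaleₚ a (f +ₚ g) ≋ (scaleₚ a f +ₚ scaleₚ a g)
scaleₚ-distribˡ a f g = mk≋ λ k → begin
  coeff (scaleₚ a (f +ₚ g)) k                           ≡⟨ coeff-scaleₚ a (f +ₚ g) k ⟩
  a ℤ.* coeff (f +ₚ g) k                                ≡⟨ cong (a ℤ.*_) (coeff-+ₚ f g k) ⟩
  a ℤ.* (coeff f k ℤ.+ coeff g k)                       ≡⟨ ℤ.*-distribˡ-+ a (coeff f k) _ ⟩
  a ℤ.* coeff f k ℤ.+ a ℤ.* coeff g k                   ≡⟨ cong₂ ℤ._+_ (coeff-scaleₚ a f k) (coeff-scaleₚ a g k) ⟨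
  coeff (scaleₚ a f) k ℤ.+ coeff (scaleₚ a g) k         ≡⟨ coeff-+ₚ (scaleₚ a f) _ k ⟨
  coeff (scaleₚ a f +ₚ scaleₚ a g) k                    ∎
  where open ≡-Reasoning

scaleₚ-distribʳ : ∀ a b f → scaleₚ (a ℤ.+ b) f ≋ (scaleₚ a f +ₚ scaleₚ b f)
scaleₚ-distribʳ a b f = mk≋ λ k → begin
  coeff (scaleₚ (a ℤ.+ b) f) k                          ≡⟨ coeff-scaleₚ (a ℤ.+ b) f k ⟩
  (a ℤ.+ b) ℤ.* coeff f k                               ≡⟨ ℤ.*-distribʳ-+ (coeff f k) a b ⟩
  a ℤ.* coeff f k ℤ.+ b ℤ.* coeff f k                   ≡⟨ cong₂ ℤ._+_ (coeff-scaleₚ a f k) (coeff-scaleₚ b f k) ⟨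
  coeff (scaleₚ a f) k ℤ.+ coeff (scaleₚ b f) k         ≡⟨ coeff-+ₚ (scaleₚ a f) _ k ⟨
  coeff (scaleₚ a f +ₚ scaleₚ b f) k                    ∎
  where open ≡-Reasoning

scaleₚ-assoc : ∀ a b f → scaleₚ a (scaleₚ b f) ≋ scaleₚ (a ℤ.* b) f
scaleₚ-assoc a b f = mk≋ λ k → begin
  coeff (scaleₚ a (scaleₚ b f)) k     ≡⟨ coeff-scaleₚ a (scaleₚ b f) k ⟩
  a ℤ.* coeff (scaleₚ b f) k          ≡⟨ cong (a ℤ.*_) (coeff-scaleₚ b f k) ⟩
  a ℤ.* (b ℤ.* coeff f k)             ≡⟨ ℤ.*-assoc a b _ ⟨
  a ℤ.* b ℤ.* coeff f k               ≡⟨ coeff-scaleₚ (a ℤ.* b) f k ⟨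
  coeff (scaleₚ (a ℤ.* b) f) k        ∎
  where open ≡-Reasoning

negₚ-cong : ∀ {f g} → f ≋ g → negₚ f ≋ negₚ g
negₚ-cong = scaleₚ-cong ℤ.-1ℤ

+ₚ-inverseʳ : ∀ f → (f +ₚ negₚ f) ≋ []
+ₚ-inverseʳ f = mk≋ λ k → begin
  coeff (f +ₚ negₚ f) k                       ≡⟨ coeff-+ₚ f (negₚ f) k ⟩
  coeff f k ℤ.+ coeff (negₚ f) k              ≡⟨ cong (ℤ._+_ (coeff f k)) (coeff-scaleₚ ℤ.-1ℤ f k) ⟩
  coeff f k ℤ.+ ℤ.-1ℤ ℤ.* coeff f k           ≡⟨ cong (ℤ._+_ (coeff f k)) (ℤ.-1*i≡-i _) ⟩
  coeff f k ℤ.+ ℤ.- coeff f k                 ≡⟨ ℤ.+-inverseʳ (coeff f k) ⟩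
  + 0                                         ∎
  where open ≡-Reasoning

+ₚ-inverseˡ : ∀ f → (negₚ f +ₚ f) ≋ []
+ₚ-inverseˡ f = ≋-trans (+ₚ-comm (negₚ f) f) (+ₚ-inverseʳ f)

*ₚ-zeroʳ : ∀ f → (f *ₚ []) ≋ []
*ₚ-zeroʳ []      = ≋-refl
*ₚ-zeroʳ (a ∷ f) = ≋-trans (shift-cong (*ₚ-zeroʳ f)) shift-[]

*ₚ-zeroˡ : ∀ {f} g → f ≋ [] → (f *ₚ g) ≋ []
*ₚ-zeroˡ {[]}    g _    = ≋-refl
*ₚ-zeroˡ {a ∷ f} g a∷f≋[] =
  +ₚ-cong (≋-trans (≡⇒≋ (cong (λ b → scaleₚ b g) (at a∷f≋[] 0))) (scaleₚ-zero g))
          (≋-trans (shift-cong (*ₚ-zeroˡ {f} g (mk≋ λ k → at a∷f≋[] (suc k)))) shift-[])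

*ₚ-congˡ : ∀ {f f′} g → f ≋ f′ → (f *ₚ g) ≋ (f′ *ₚ g)
*ₚ-congˡ {[]}    {[]}      g _ = ≋-refl
*ₚ-congˡ {[]}    {_ ∷ _}   g f≋f′ = ≋-sym (*ₚ-zeroˡ g (≋-sym f≋f′))
*ₚ-congˡ {_ ∷ _} {[]}      g f≋f′ = *ₚ-zeroˡ g f≋f′
*ₚ-congˡ {a ∷ f} {a′ ∷ f′} g f≋f′ =
  +ₚ-cong (≡⇒≋ (cong (λ b → scaleₚ b g) (at f≋f′ 0)))
          (shift-cong (*ₚ-congˡ {f} {f′} g (mk≋ λ k → at f≋f′ (suc k))))

*ₚ-congʳ : ∀ f {g g′} → g ≋ g′ → (f *ₚ g) ≋ (f *ₚ g′)
*ₚ-congʳ []      g≋g′ = ≋-refl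
*ₚ-congʳ (a ∷ f) g≋g′ = +ₚ-cong (scaleₚ-cong a g≋g′) (shift-cong (*ₚ-congʳ f g≋g′))

*ₚ-cong : ∀ {f f′ g g′} → f ≋ f′ → g ≋ g′ → (f *ₚ g) ≋ (f′ *ₚ g′)
*ₚ-cong {f′ = f′} {g = g} f≋f′ g≋g′ = ≋-trans (*ₚ-congˡ g f≋f′) (*ₚ-congʳ f′ g≋g′)

*ₚ-distribˡ : ∀ f g h → (f *ₚ (g +ₚ h)) ≋ ((f *ₚ g) +ₚ (f *ₚ h))
*ₚ-distribˡ []      g h = ≋-refl
*ₚ-distribˡ (a ∷ f) g h = begin
  scaleₚ a (g +ₚ h) +ₚ shift (f *ₚ (g +ₚ h))
    ≈⟨ +ₚ-cong (scaleₚ-distribˡ a g h) (shift-cong (*ₚ-distribˡ f g h)) ⟩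
  (scaleₚ a g +ₚ scaleₚ a h) +ₚ (shift (f *ₚ g) +ₚ shift (f *ₚ h))
    ≈⟨ +ₚ-interchange (scaleₚ a g) _ _ _ ⟩
  (scaleₚ a g +ₚ shift (f *ₚ g)) +ₚ (scaleₚ a h +ₚ shift (f *ₚ h))
    ∎
  where open ≋-Reasoning

*ₚ-distribʳ : ∀ f g h → ((f +ₚ g) *ₚ h) ≋ ((f *ₚ h) +ₚ (g *ₚ h))
*ₚ-distribʳ []      g       h = ≋-refl
*ₚ-distribʳ (a ∷ f) []      h = ≋-sym (+ₚ-identityʳ _)
*ₚ-distribʳ (a ∷ f) (b ∷ g) h = begin
  scaleₚ (a ℤ.+ b) h +ₚ shift ((f +ₚ g) *ₚ h)
    ≈⟨ +ₚ-cong (scaleₚ-distribʳ a b h) (shift-cong (*ₚ-distribʳ f g h)) ⟩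
  (scaleₚ a h +ₚ scaleₚ b h) +ₚ (shift (f *ₚ h) +ₚ shift (g *ₚ h))
    ≈⟨ +ₚ-interchange (scaleₚ a h) _ _ _ ⟩
  (scaleₚ a h +ₚ shift (f *ₚ h)) +ₚ (scaleₚ b h +ₚ shift (g *ₚ h))
    ∎
  where open ≋-Reasoning

*ₚ-∷ʳ : ∀ f b g → (f *ₚ (b ∷ g)) ≋ (scaleₚ b f +ₚ shift (f *ₚ g))
*ₚ-∷ʳ []      b g = ≋-sym shift-[]
*ₚ-∷ʳ (a ∷ f) b g = ≋-trans (+ₚ-cong (≋-refl {a ℤ.* b ∷ scaleₚ a g}) (shift-cong (*ₚ-∷ʳ f b g)))
  (∷-cong (cong (ℤ._+ + 0) (ℤ.*-comm a b)) (+ₚ-left-comm (scaleₚ a g) (scaleₚ b f) _))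

*ₚ-comm : ∀ f g → (f *ₚ g) ≋ (g *ₚ f)
*ₚ-comm []      g = ≋-sym (*ₚ-zeroʳ g)
*ₚ-comm (a ∷ f) g = ≋-trans (+ₚ-cong (≋-refl {scaleₚ a g}) (shift-cong (*ₚ-comm f g))) (≋-sym (*ₚ-∷ʳ g a f))

scaleₚ-*ₚ : ∀ a f g → (scaleₚ a f *ₚ g) ≋ scaleₚ a (f *ₚ g)
scaleₚ-*ₚ a []      g = ≋-refl
scaleₚ-*ₚ a (b ∷ f) g = begin
  scaleₚ (a ℤ.* b) g +ₚ shift (scaleₚ a f *ₚ g)
    ≈⟨ +ₚ-cong (≋-sym (scaleₚ-assoc a b g)) (shift-cong (scaleₚ-*ₚ a f g)) ⟩
  scaleₚ a (scaleₚ b g) +ₚ shift (scaleₚ a (f *ₚ g))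
    ≈⟨ +ₚ-cong (≋-refl {scaleₚ a (scaleₚ b g)}) (scaleₚ-shift a (f *ₚ g)) ⟨
  scaleₚ a (scaleₚ b g) +ₚ scaleₚ a (shift (f *ₚ g))
    ≈⟨ scaleₚ-distribˡ a (scaleₚ b g) _ ⟨
  scaleₚ a (scaleₚ b g +ₚ shift (f *ₚ g))
    ∎
  where open ≋-Reasoning

shift-*ₚ : ∀ f g → (shift f *ₚ g) ≋ shift (f *ₚ g)
shift-*ₚ f g = +ₚ-cong (scaleₚ-zero g) ≋-refl

*ₚ-assoc : ∀ f g h → ((f *ₚ g) *ₚ h) ≋ (f *ₚ (g *ₚ h))
*ₚ-assoc []      g h = ≋-refl
*ₚ-assoc (a ∷ f) g h = ≋-trans (*ₚ-distribʳ (scaleₚ a g) (shift (f *ₚ g)) h)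
  (+ₚ-cong (scaleₚ-*ₚ a g h) (≋-trans (shift-*ₚ (f *ₚ g) h) (shift-cong (*ₚ-assoc f g h))))

*ₚ-identityˡ : ∀ f → (oneₚ *ₚ f) ≋ f
*ₚ-identityˡ f = ≋-trans (+ₚ-cong (scaleₚ-identity f) shift-[]) (+ₚ-identityʳ f)

*ₚ-identityʳ : ∀ f → (f *ₚ oneₚ) ≋ f
*ₚ-identityʳ f = ≋-trans (*ₚ-comm f oneₚ) (*ₚ-identityˡ f)

polyCommutativeRing : CommutativeRing 0ℓ 0ℓ
polyCommutativeRing = record
  { Carrier = Poly ; _≈_ = _≋_ ; _+_ = _+ₚ_ ; _*_ = _*ₚ_ ; -_ = negₚ ; 0# = [] ; 1# = oneₚ
  ; isCommutativeRing = record
    { isRing = record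
      { +-isAbelianGroup = record
        { isGroup = record
          { isMonoid = record
            { isSemigroup = CommutativeSemigroup.isSemigroup +ₚ-commutativeSemigroup
            ; identity = (λ _ → ≋-refl) , +ₚ-identityʳ }
          ; inverse = +ₚ-inverseˡ , +ₚ-inverseʳ
          ; ⁻¹-cong = negₚ-cong }
        ; comm = +ₚ-comm }
      ; *-cong = *ₚ-cong
      ; *-assoc = *ₚ-assoc
      ; *-identity = *ₚ-identityˡ , *ₚ-identityʳ
      ; distrib = *ₚ-distribˡ , λ h f g → *ₚ-distribʳ f g h }
    ; *-comm = *ₚ-comm } }

-- A zero test lets the ring solver discard vanishing coefficients.
≋[]? : (f : Poly) → Maybe ([] ≋ f)
≋[]? []      = just ≋-refl
≋[]? (+0 ∷ f) with ≋[]? f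
... | just []≋f = just (≋-trans (≋-sym shift-[]) (shift-cong []≋f))
... | nothing   = nothing
≋[]? (_ ∷ _) = nothing

polyRing : ACR.AlmostCommutativeRing 0ℓ 0ℓ
polyRing = ACR.fromCommutativeRing polyCommutativeRing ≋[]?

*ₚ-interchange : ∀ a b c d → ((a *ₚ b) *ₚ (c *ₚ d)) ≋ ((a *ₚ c) *ₚ (b *ₚ d))
*ₚ-interchange = solve-∀ polyRing

constₚ : ℤ → Poly
constₚ a = a ∷ []

constₚ-*ₚ : ∀ a f → (constₚ a *ₚ f) ≋ scaleₚ a f
constₚ-*ₚ a f = ≋-trans (+ₚ-cong (≋-refl {scaleₚ a f}) shift-[]) (+ₚ-identityʳ (scaleₚ a f))

constₚ-* : ∀ a b → (constₚ a *ₚ constₚ b) ≋ constₚ (a ℤ.* b)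
constₚ-* a b = constₚ-*ₚ a (constₚ b)

coeff₀-*ₚ : ∀ f g → coeff (f *ₚ g) 0 ≡ coeff f 0 ℤ.* coeff g 0
coeff₀-*ₚ []      g = sym (ℤ.*-zeroˡ (coeff g 0))
coeff₀-*ₚ (a ∷ f) g = trans (coeff-∷-*ₚ a f g 0) (ℤ.+-identityʳ _)

*-≢0 : ∀ {a b} → a ≢ + 0 → b ≢ + 0 → a ℤ.* b ≢ + 0
*-≢0 {a} a≢0 b≢0 ab≡0 with ℤ.i*j≡0⇒i≡0∨j≡0 a ab≡0
... | inj₁ a≡0 = a≢0 a≡0
... | inj₂ b≡0 = b≢0 b≡0

constₚ-*ₚ-≋[] : ∀ {a f} → a ≢ + 0 → (constₚ a *ₚ f) ≋ [] → f ≋ []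
constₚ-*ₚ-≋[] {a} {f} a≢0 af≋[] =
  mk≋ λ k → cancel k (trans (sym (coeff-scaleₚ a f k)) (at (≋-trans (≋-sym (constₚ-*ₚ a f)) af≋[]) k))
  where
  cancel : ∀ k → a ℤ.* coeff f k ≡ + 0 → coeff f k ≡ + 0
  cancel k e with ℤ.i*j≡0⇒i≡0∨j≡0 a e
  ... | inj₁ a≡0 = ⊥-elim (a≢0 a≡0)
  ... | inj₂ c≡0 = c≡0

-- A constant term ±1 makes a polynomial invertible in ℤ[[x]]; this replaces unique factorisation below.
record UnitConstant (f : Poly) : Set where
  constructor unitConstant
  field
    inverse         : ℤ
    inverse-correct : coeff f 0 ℤ.* inverse ≡ + 1
open UnitConstant public

x*f₀≡y⇒x≡y*inverse : ∀ {f} (u : UnitConstant f) {x y} → x ℤ.* coeff f 0 ≡ y → x ≡ y ℤ.* inverse u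
x*f₀≡y⇒x≡y*inverse {f} (unitConstant v f₀v≡1) {x} {y} xf₀≡y = begin
  x                            ≡⟨ ℤ.*-identityʳ x ⟨
  x ℤ.* + 1                    ≡⟨ cong (ℤ._*_ x) f₀v≡1 ⟨
  x ℤ.* (coeff f 0 ℤ.* v)      ≡⟨ ℤ.*-assoc x (coeff f 0) v ⟨
  x ℤ.* coeff f 0 ℤ.* v        ≡⟨ cong (ℤ._* v) xf₀≡y ⟩
  y ℤ.* v                      ∎
  where open ≡-Reasoning

UnitConstant-oneₚ : UnitConstant oneₚ
UnitConstant-oneₚ = unitConstant (+ 1) refl

UnitConstant-*ₚ : ∀ {f g} → UnitConstant f → UnitConstant g → UnitConstant (f *ₚ g)
UnitConstant-*ₚ {f} {g} (unitConstant u f₀u≡1) (unitConstant v g₀v≡1) = unitConstant (u ℤ.* v) (begin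
  coeff (f *ₚ g) 0 ℤ.* (u ℤ.* v)              ≡⟨ cong (ℤ._* (u ℤ.* v)) (coeff₀-*ₚ f g) ⟩
  coeff f 0 ℤ.* coeff g 0 ℤ.* (u ℤ.* v)       ≡⟨ interchange (coeff f 0) (coeff g 0) u v ⟩
  (coeff f 0 ℤ.* u) ℤ.* (coeff g 0 ℤ.* v)     ≡⟨ cong₂ ℤ._*_ f₀u≡1 g₀v≡1 ⟩
  + 1                                         ∎)
  where
  open ≡-Reasoning
  interchange : ∀ a b c d → a ℤ.* b ℤ.* (c ℤ.* d) ≡ (a ℤ.* c) ℤ.* (b ℤ.* d)
  interchange = ℤ-Solver.solve-∀

UnitConstant-^ₚ : ∀ {f} k → UnitConstant f → UnitConstant (f ^ₚ k)
UnitConstant-^ₚ zero    u = UnitConstant-oneₚ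
UnitConstant-^ₚ (suc k) u = UnitConstant-*ₚ u (UnitConstant-^ₚ k u)

infix 4 _∣_
record _∣_ (d f : Poly) : Set where
  constructor divides
  field
    quotient : Poly
    equality : (d *ₚ quotient) ≋ f
open _∣_ public

∣-refl : ∀ f → f ∣ f
∣-refl f = divides oneₚ (*ₚ-identityʳ f)

∣-resp : ∀ {d d′ f f′} → d ≋ d′ → f ≋ f′ → d ∣ f → d′ ∣ f′
∣-resp {d} {d′} d≋d′ f≋f′ (divides q dq≋f) = divides q (≋-trans (*ₚ-congˡ q (≋-sym d≋d′)) (≋-trans dq≋f f≋f′))

∣-trans : ∀ {a b c} → a ∣ b → b ∣ c → a ∣ c
∣-trans {a} (divides q aq≋b) (divides r br≋c) =
  divides (q *ₚ r) (≋-trans (≋-sym (*ₚ-assoc a q r)) (≋-trans (*ₚ-congˡ r aq≋b) br≋c))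

f∣f*ₚg : ∀ f g → f ∣ (f *ₚ g)
f∣f*ₚg f g = divides g ≋-refl

∣-*ₚʳ : ∀ {a b} c → a ∣ b → a ∣ (b *ₚ c)
∣-*ₚʳ {b = b} c a∣b = ∣-trans a∣b (f∣f*ₚg b c)

∣-*ₚˡ : ∀ {a b} c → a ∣ b → a ∣ (c *ₚ b)
∣-*ₚˡ {b = b} c a∣b = ∣-resp ≋-refl (*ₚ-comm b c) (∣-*ₚʳ c a∣b)

*ₚ-∣-*ₚ : ∀ {a b c d} → a ∣ b → c ∣ d → (a *ₚ c) ∣ (b *ₚ d)
*ₚ-∣-*ₚ {a} {b} {c} {d} (divides q aq≋b) (divides r cr≋d) = divides (q *ₚ r)
  (≋-trans (*ₚ-interchange a c q r) (*ₚ-cong aq≋b cr≋d))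

∣-UnitConstant : ∀ {e f} → e ∣ f → UnitConstant f → UnitConstant e
∣-UnitConstant {e} {f} (divides q eq≋f) (unitConstant u f₀u≡1) = unitConstant (coeff q 0 ℤ.* u) (begin
  coeff e 0 ℤ.* (coeff q 0 ℤ.* u)     ≡⟨ ℤ.*-assoc (coeff e 0) (coeff q 0) u ⟨
  coeff e 0 ℤ.* coeff q 0 ℤ.* u       ≡⟨ cong (ℤ._* u) (trans (sym (coeff₀-*ₚ e q)) (at eq≋f 0)) ⟩
  coeff f 0 ℤ.* u                     ≡⟨ f₀u≡1 ⟩
  + 1                                 ∎)
  where open ≡-Reasoning

shift-injective : ∀ {f g} → shift f ≋ shift g → f ≋ g
shift-injective sf≋sg = mk≋ λ k → at sf≋sg (suc k)

*ₚ-shift : ∀ f g → (f *ₚ shift g) ≋ shift (f *ₚ g)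
*ₚ-shift f g = ≋-trans (*ₚ-comm f (shift g)) (≋-trans (shift-*ₚ g f) (shift-cong (*ₚ-comm g f)))

*ₚ-∷ʳ-constₚ : ∀ f b g → (f *ₚ (b ∷ g)) ≋ ((constₚ b *ₚ f) +ₚ shift (f *ₚ g))
*ₚ-∷ʳ-constₚ f b g = ≋-trans (*ₚ-∷ʳ f b g) (+ₚ-cong (≋-sym (constₚ-*ₚ b f)) ≋-refl)

*ₚ-cancelˡ-≋[] : ∀ {a} → UnitConstant a → ∀ f → (a *ₚ f) ≋ [] → f ≋ []
*ₚ-cancelˡ-≋[] ua []      _ = ≋-refl
*ₚ-cancelˡ-≋[] {a} ua (b ∷ f) a[b∷f]≋[] = ≋-trans (∷-cong b≡0 f≋[]) shift-[]
  where
  b≡0 : b ≡ + 0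
  b≡0 = trans (x*f₀≡y⇒x≡y*inverse ua (trans (ℤ.*-comm b (coeff a 0)) (trans (sym (coeff₀-*ₚ a (b ∷ f))) (at a[b∷f]≋[] 0))))
              (ℤ.*-zeroˡ (inverse ua))
  b·a≋[] : scaleₚ b a ≋ []
  b·a≋[] = ≋-trans (≡⇒≋ (cong (λ c → scaleₚ c a) b≡0)) (scaleₚ-zero a)
  x·af≋[] : shift (a *ₚ f) ≋ []
  x·af≋[] = ≋-trans (+ₚ-cong (≋-sym b·a≋[]) ≋-refl) (≋-trans (≋-sym (*ₚ-∷ʳ a b f)) a[b∷f]≋[])
  f≋[] : f ≋ []
  f≋[] = *ₚ-cancelˡ-≋[] ua f (shift-injective (≋-trans x·af≋[] (≋-sym shift-[])))

*ₚ-cancelˡ : ∀ {a f g} → UnitConstant a → (a *ₚ f) ≋ (a *ₚ g) → f ≋ g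
*ₚ-cancelˡ {a} {f} {g} ua af≋ag = begin
  f                       ≈⟨ solve (f ∷ g ∷ []) polyRing ⟩
  (f +ₚ negₚ g) +ₚ g      ≈⟨ +ₚ-cong f-g≋[] ≋-refl ⟩
  g                       ∎
  where
  open ≋-Reasoning
  f-g≋[] : (f +ₚ negₚ g) ≋ []
  f-g≋[] = *ₚ-cancelˡ-≋[] ua (f +ₚ negₚ g) (begin
    a *ₚ (f +ₚ negₚ g)               ≈⟨ solve (a ∷ f ∷ g ∷ []) polyRing ⟩
    (a *ₚ f) +ₚ negₚ (a *ₚ g)        ≈⟨ +ₚ-cong af≋ag ≋-refl ⟩
    (a *ₚ g) +ₚ negₚ (a *ₚ g)        ≈⟨ +ₚ-inverseʳ (a *ₚ g) ⟩
    []                               ∎)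

coeff-negₚ : ∀ f k → coeff (negₚ f) k ≡ ℤ.- coeff f k
coeff-negₚ f k = trans (coeff-scaleₚ ℤ.-1ℤ f k) (ℤ.-1*i≡-i (coeff f k))

tailₚ : Poly → Poly
tailₚ []      = []
tailₚ (_ ∷ f) = f

shift-tailₚ : ∀ f → coeff f 0 ≡ + 0 → shift (tailₚ f) ≋ f
shift-tailₚ []      _   = shift-[]
shift-tailₚ (a ∷ f) a≡0 = ∷-cong (sym a≡0) ≋-refl

-- Long division by e in order of increasing degree, which never leaves ℤ[x] because e₀ = ±1.
module ExactDivision {e} (ue : UnitConstant e) {N} (N≢0 : N ≢ + 0) where

  quotient₀ : Poly → ℤ
  quotient₀ f = coeff f 0 ℤ.* inverse ue

  remainder : Poly → Poly
  remainder f = f +ₚ negₚ (constₚ (quotient₀ f) *ₚ e)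

  remainder₀≡0 : ∀ f → coeff (remainder f) 0 ≡ + 0
  remainder₀≡0 f = begin
    coeff (remainder f) 0                              ≡⟨ coeff-+ₚ f _ 0 ⟩
    coeff f 0 ℤ.+ coeff (negₚ (constₚ β *ₚ e)) 0       ≡⟨ cong (ℤ._+_ (coeff f 0)) (coeff-negₚ (constₚ β *ₚ e) 0) ⟩
    coeff f 0 ℤ.- coeff (constₚ β *ₚ e) 0              ≡⟨ cong (λ z → coeff f 0 ℤ.- z) (coeff₀-*ₚ (constₚ β) e) ⟩
    coeff f 0 ℤ.- β ℤ.* coeff e 0                      ≡⟨ cong (λ z → coeff f 0 ℤ.- z) β·e₀≡f₀ ⟩
    coeff f 0 ℤ.- coeff f 0                            ≡⟨ ℤ.+-inverseʳ (coeff f 0) ⟩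
    + 0                                                ∎
    where
    open ≡-Reasoning
    β = quotient₀ f
    β·e₀≡f₀ : β ℤ.* coeff e 0 ≡ coeff f 0
    β·e₀≡f₀ = begin
      coeff f 0 ℤ.* inverse ue ℤ.* coeff e 0       ≡⟨ ℤ.*-assoc (coeff f 0) _ _ ⟩
      coeff f 0 ℤ.* (inverse ue ℤ.* coeff e 0)     ≡⟨ cong (ℤ._*_ (coeff f 0)) (trans (ℤ.*-comm _ (coeff e 0)) (inverse-correct ue)) ⟩
      coeff f 0 ℤ.* + 1                            ≡⟨ ℤ.*-identityʳ (coeff f 0) ⟩
      coeff f 0                                    ∎

  division-step : ∀ b q f → (e *ₚ (b ∷ q)) ≋ (constₚ N *ₚ f) → (e *ₚ q) ≋ (constₚ N *ₚ tailₚ (remainder f))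
  division-step b q f e[b∷q]≋Nf = shift-injective (begin
    shift (e *ₚ q)                                          ≈⟨ add-sub (constₚ b *ₚ e) _ ⟩
    ((constₚ b *ₚ e) +ₚ shift (e *ₚ q)) +ₚ negₚ (constₚ b *ₚ e)
      ≈⟨ +ₚ-cong (≋-trans (≋-sym (*ₚ-∷ʳ-constₚ e b q)) e[b∷q]≋Nf) (negₚ-cong (*ₚ-congˡ e b≋Nβ)) ⟩
    (constₚ N *ₚ f) +ₚ negₚ ((constₚ N *ₚ constₚ β) *ₚ e)   ≈⟨ factor (constₚ N) f (constₚ β) e ⟩
    constₚ N *ₚ remainder f                                 ≈⟨ *ₚ-congʳ (constₚ N) (shift-tailₚ _ (remainder₀≡0 f)) ⟨
    constₚ N *ₚ shift (tailₚ (remainder f))                 ≈⟨ *ₚ-shift (constₚ N) _ ⟩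
    shift (constₚ N *ₚ tailₚ (remainder f))                 ∎)
    where
    open ≋-Reasoning
    β = quotient₀ f
    b≋Nβ : constₚ b ≋ (constₚ N *ₚ constₚ β)
    b≋Nβ = ≋-trans (≡⇒≋ (cong constₚ b≡Nβ)) (≋-sym (constₚ-* N β))
      where
      b·e₀≡N·f₀ : b ℤ.* coeff e 0 ≡ N ℤ.* coeff f 0
      b·e₀≡N·f₀ = trans (ℤ.*-comm b _) (trans (sym (coeff₀-*ₚ e (b ∷ q))) (trans (at e[b∷q]≋Nf 0) (coeff₀-*ₚ (constₚ N) f)))
      b≡Nβ : b ≡ N ℤ.* β
      b≡Nβ = trans (x*f₀≡y⇒x≡y*inverse ue b·e₀≡N·f₀) (ℤ.*-assoc N (coeff f 0) (inverse ue))
    add-sub : ∀ a x → x ≋ ((a +ₚ x) +ₚ negₚ a)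
    add-sub = solve-∀ polyRing
    factor : ∀ n f c e → ((n *ₚ f) +ₚ negₚ ((n *ₚ c) *ₚ e)) ≋ (n *ₚ (f +ₚ negₚ (c *ₚ e)))
    factor = solve-∀ polyRing

  exact-division : ∀ q {f} → (e *ₚ q) ≋ (constₚ N *ₚ f) → e ∣ f
  exact-division [] {f} e[]≋Nf =
    divides [] (≋-trans (*ₚ-zeroʳ e) (≋-sym (constₚ-*ₚ-≋[] N≢0 (≋-trans (≋-sym e[]≋Nf) (*ₚ-zeroʳ e)))))
  exact-division (b ∷ q) {f} e[b∷q]≋Nf with exact-division q (division-step b q f e[b∷q]≋Nf)
  ... | divides s es≋r′ = divides (quotient₀ f ∷ s) (begin
    e *ₚ (quotient₀ f ∷ s)                                    ≈⟨ *ₚ-∷ʳ-constₚ e (quotient₀ f) s ⟩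
    (constₚ (quotient₀ f) *ₚ e) +ₚ shift (e *ₚ s)
      ≈⟨ +ₚ-cong ≋-refl (≋-trans (shift-cong es≋r′) (shift-tailₚ _ (remainder₀≡0 f))) ⟩
    (constₚ (quotient₀ f) *ₚ e) +ₚ remainder f                ≈⟨ add-sub (constₚ (quotient₀ f) *ₚ e) f ⟩
    f                                                       ∎)
    where
    open ≋-Reasoning
    add-sub : ∀ a f → (a +ₚ (f +ₚ negₚ a)) ≋ f
    add-sub = solve-∀ polyRing

open ExactDivision using (exact-division)

-- Divisibility in ℚ[x], with the denominator cleared by a nonzero integer.
infix 4 _∣ℚ_
record _∣ℚ_ (e f : Poly) : Set where
  constructor dividesℚ
  field
    denominator      : ℤ
    denominator≢0    : denominator ≢ + 0
    divides-multiple : e ∣ (constₚ denominator *ₚ f)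

∣⇒∣ℚ : ∀ {e f} → e ∣ f → e ∣ℚ f
∣⇒∣ℚ {f = f} e∣f = dividesℚ (+ 1) (λ ()) (∣-resp ≋-refl (≋-sym (*ₚ-identityˡ f)) e∣f)

∣ℚ⇒∣ : ∀ {e f} → UnitConstant e → e ∣ℚ f → e ∣ f
∣ℚ⇒∣ ue (dividesℚ N N≢0 (divides q eq≋Nf)) = exact-division ue N≢0 q eq≋Nf

∣ℚ-∣-trans : ∀ {e f g} → e ∣ℚ f → f ∣ g → e ∣ℚ g
∣ℚ-∣-trans {f = f} (dividesℚ N N≢0 e∣Nf) (divides q fq≋g) =
  dividesℚ N N≢0 (∣-resp ≋-refl (≋-trans (*ₚ-assoc (constₚ N) f q) (*ₚ-congʳ (constₚ N) fq≋g)) (∣-*ₚʳ q e∣Nf))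

∣ℚ-respʳ : ∀ {e f g} → f ≋ g → e ∣ℚ f → e ∣ℚ g
∣ℚ-respʳ {f = f} f≋g e∣ℚf = ∣ℚ-∣-trans e∣ℚf (∣-resp ≋-refl f≋g (∣-refl f))

-- Coprimality in ℚ[x]: a Bézout identity whose right-hand side is a nonzero integer.
record Coprime (a b : Poly) : Set where
  constructor coprime
  field
    N      : ℤ
    N≢0    : N ≢ + 0
    u v    : Poly
    bezout : ((u *ₚ a) +ₚ (v *ₚ b)) ≋ constₚ N

Coprime-sym : ∀ {a b} → Coprime a b → Coprime b a
Coprime-sym {a} {b} (coprime N N≢0 u v bezout) = coprime N N≢0 v u (≋-trans (+ₚ-comm (v *ₚ b) (u *ₚ a)) bezout)

Coprime-resp : ∀ {a a′ b b′} → a ≋ a′ → b ≋ b′ → Coprime a b → Coprime a′ b′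
Coprime-resp a≋a′ b≋b′ (coprime N N≢0 u v bezout) =
  coprime N N≢0 u v (≋-trans (+ₚ-cong (*ₚ-congʳ u (≋-sym a≋a′)) (*ₚ-congʳ v (≋-sym b≋b′))) bezout)

Coprime-∣ˡ : ∀ {a a′ b} → a′ ∣ a → Coprime a b → Coprime a′ b
Coprime-∣ˡ {a′ = a′} {b} (divides α a′α≋a) (coprime N N≢0 u v bezout) = coprime N N≢0 (u *ₚ α) v
  (≋-trans (+ₚ-cong (≋-trans (*ₚ-assoc u α a′) (*ₚ-congʳ u (≋-trans (*ₚ-comm α a′) a′α≋a))) (≋-refl {v *ₚ b})) bezout)

Coprime-oneₚ : ∀ a → Coprime a oneₚ
Coprime-oneₚ a = coprime (+ 1) (λ ()) [] oneₚ (*ₚ-identityˡ oneₚ)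

Coprime-*ₚ : ∀ {a b c} → Coprime a b → Coprime a c → Coprime a (b *ₚ c)
Coprime-*ₚ {a} {b} {c} (coprime M M≢0 u v uv≋M) (coprime N N≢0 u′ v′ uv′≋N) =
  coprime (M ℤ.* N) (*-≢0 M≢0 N≢0) ((((u *ₚ u′) *ₚ a) +ₚ ((u *ₚ v′) *ₚ c)) +ₚ ((v *ₚ b) *ₚ u′)) (v *ₚ v′)
    (≋-trans (≋-sym (expand u v u′ v′ a b c)) (≋-trans (*ₚ-cong uv≋M uv′≋N) (constₚ-* M N)))
  where
  expand : ∀ u v u′ v′ a b c → (((u *ₚ a) +ₚ (v *ₚ b)) *ₚ ((u′ *ₚ a) +ₚ (v′ *ₚ c)))
         ≋ ((((((u *ₚ u′) *ₚ a) +ₚ ((u *ₚ v′) *ₚ c)) +ₚ ((v *ₚ b) *ₚ u′)) *ₚ a) +ₚ ((v *ₚ v′) *ₚ (b *ₚ c)))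
  expand = solve-∀ polyRing

Coprime-^ₚ : ∀ {a b} k → Coprime a b → Coprime a (b ^ₚ k)
Coprime-^ₚ {a} zero    _   = Coprime-oneₚ a
Coprime-^ₚ     (suc k) a⊥b = Coprime-*ₚ a⊥b (Coprime-^ₚ k a⊥b)

∣ℚ-cancel-Coprime : ∀ {e x y z} → e ∣ℚ (x *ₚ z) → e ∣ℚ (y *ₚ z) → Coprime x y → e ∣ℚ z
∣ℚ-cancel-Coprime {e} {x} {y} {z} (dividesℚ N₁ N₁≢0 (divides q₁ eq₁≋N₁xz))
                                   (dividesℚ N₂ N₂≢0 (divides q₂ eq₂≋N₂yz))
                  (coprime N N≢0 u v bezout) =
  dividesℚ (N₁ ℤ.* N₂ ℤ.* N) (*-≢0 (*-≢0 N₁≢0 N₂≢0) N≢0)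
    (divides (((c₂ *ₚ u) *ₚ q₁) +ₚ ((c₁ *ₚ v) *ₚ q₂)) (begin
    e *ₚ (((c₂ *ₚ u) *ₚ q₁) +ₚ ((c₁ *ₚ v) *ₚ q₂))      ≈⟨ distribute e (c₂ *ₚ u) q₁ (c₁ *ₚ v) q₂ ⟩
    ((c₂ *ₚ u) *ₚ (e *ₚ q₁)) +ₚ ((c₁ *ₚ v) *ₚ (e *ₚ q₂))
                                                       ≈⟨ +ₚ-cong (*ₚ-congʳ (c₂ *ₚ u) eq₁≋N₁xz) (*ₚ-congʳ (c₁ *ₚ v) eq₂≋N₂yz) ⟩
    ((c₂ *ₚ u) *ₚ (c₁ *ₚ (x *ₚ z))) +ₚ ((c₁ *ₚ v) *ₚ (c₂ *ₚ (y *ₚ z)))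
                                                       ≈⟨ collect c₁ c₂ u v x y z ⟩
    ((c₁ *ₚ c₂) *ₚ ((u *ₚ x) +ₚ (v *ₚ y))) *ₚ z        ≈⟨ *ₚ-congˡ z (*ₚ-cong (constₚ-* N₁ N₂) bezout) ⟩
    (constₚ (N₁ ℤ.* N₂) *ₚ constₚ N) *ₚ z              ≈⟨ *ₚ-congˡ z (constₚ-* (N₁ ℤ.* N₂) N) ⟩
    constₚ (N₁ ℤ.* N₂ ℤ.* N) *ₚ z                      ∎))
  where
  open ≋-Reasoning
  c₁ = constₚ N₁
  c₂ = constₚ N₂
  distribute : ∀ e a q b r → (e *ₚ ((a *ₚ q) +ₚ (b *ₚ r))) ≋ ((a *ₚ (e *ₚ q)) +ₚ (b *ₚ (e *ₚ r)))
  distribute = solve-∀ polyRing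
  collect : ∀ c₁ c₂ u v x y z → (((c₂ *ₚ u) *ₚ (c₁ *ₚ (x *ₚ z))) +ₚ ((c₁ *ₚ v) *ₚ (c₂ *ₚ (y *ₚ z))))
          ≋ (((c₁ *ₚ c₂) *ₚ ((u *ₚ x) +ₚ (v *ₚ y))) *ₚ z)
  collect = solve-∀ polyRing

Coprime-*ₚ-∣ : ∀ {a b f} → UnitConstant a → UnitConstant b → a ∣ f → b ∣ f → Coprime a b → (a *ₚ b) ∣ f
Coprime-*ₚ-∣ {a} {b} {f} ua ub a∣f b∣f a⊥b = ∣ℚ⇒∣ (UnitConstant-*ₚ ua ub)
  (∣ℚ-cancel-Coprime (∣⇒∣ℚ ab∣bf) (∣⇒∣ℚ ab∣af) (Coprime-sym a⊥b))
  where
  ab∣bf : (a *ₚ b) ∣ (b *ₚ f)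
  ab∣bf = ∣-resp ≋-refl (*ₚ-comm f b) (*ₚ-∣-*ₚ a∣f (∣-refl b))
  ab∣af : (a *ₚ b) ∣ (a *ₚ f)
  ab∣af = *ₚ-∣-*ₚ (∣-refl a) b∣f

oneMinusX : ℕ → Poly
oneMinusX m = oneₚ +ₚ negₚ (xpow m)

xpow-+ : ∀ a b → (xpow a *ₚ xpow b) ≋ xpow (a ℕ.+ b)
xpow-+ zero    b = *ₚ-identityˡ (xpow b)
xpow-+ (suc a) b = ≋-trans (shift-*ₚ (xpow a) (xpow b)) (shift-cong (xpow-+ a b))

oneMinusX-+ : ∀ a b → oneMinusX (a ℕ.+ b) ≋ (oneMinusX a +ₚ (xpow a *ₚ oneMinusX b))
oneMinusX-+ a b = ≋-trans (+ₚ-cong ≋-refl (negₚ-cong (≋-sym (xpow-+ a b)))) (telescope (xpow a) (xpow b))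
  where
  telescope : ∀ x y → (oneₚ +ₚ negₚ (x *ₚ y)) ≋ ((oneₚ +ₚ negₚ x) +ₚ (x *ₚ (oneₚ +ₚ negₚ y)))
  telescope = solve-∀ polyRing

oneMinusX-0 : oneMinusX 0 ≋ []
oneMinusX-0 = mk≋ λ { zero → refl ; (suc k) → refl }

geometric : ℕ → ℕ → Poly
geometric g zero    = []
geometric g (suc s) = geometric g s +ₚ xpow (g ℕ.* s)

oneMinusX-* : ∀ g s → oneMinusX (g ℕ.* s) ≋ (oneMinusX g *ₚ geometric g s)
oneMinusX-* g zero    = ≋-trans (≡⇒≋ (cong oneMinusX (ℕ.*-zeroʳ g))) (≋-trans oneMinusX-0 (≋-sym (*ₚ-zeroʳ (oneMinusX g))))
oneMinusX-* g (suc s) = begin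
  oneMinusX (g ℕ.* suc s)                                         ≡⟨ cong oneMinusX (trans (ℕ.*-suc g s) (ℕ.+-comm g _)) ⟩
  oneMinusX (g ℕ.* s ℕ.+ g)                                       ≈⟨ oneMinusX-+ (g ℕ.* s) g ⟩
  oneMinusX (g ℕ.* s) +ₚ (xpow (g ℕ.* s) *ₚ oneMinusX g)           ≈⟨ +ₚ-cong (oneMinusX-* g s) (*ₚ-comm (xpow (g ℕ.* s)) _) ⟩
  (oneMinusX g *ₚ geometric g s) +ₚ (oneMinusX g *ₚ xpow (g ℕ.* s)) ≈⟨ *ₚ-distribˡ (oneMinusX g) _ _ ⟨
  oneMinusX g *ₚ geometric g (suc s)                              ∎
  where open ≋-Reasoning

oneMinusX-∣ : ∀ {a b} → a ℕ.∣ b → oneMinusX a ∣ oneMinusX b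
oneMinusX-∣ {a} (ℕ.divides s refl) = divides (geometric a s) (≋-sym (≋-trans (≡⇒≋ (cong oneMinusX (ℕ.*-comm s a))) (oneMinusX-* a s)))

∣-+ₚ : ∀ {d f g} → d ∣ f → d ∣ g → d ∣ (f +ₚ g)
∣-+ₚ {d} (divides q dq≋f) (divides r dr≋g) = divides (q +ₚ r) (≋-trans (*ₚ-distribˡ d q r) (+ₚ-cong dq≋f dr≋g))

∣-negₚ : ∀ {d f} → d ∣ f → d ∣ negₚ f
∣-negₚ {d} (divides q dq≋f) = divides (negₚ q) (≋-trans (negₚ-*ₚ d q) (negₚ-cong dq≋f))
  where
  negₚ-*ₚ : ∀ d q → (d *ₚ negₚ q) ≋ negₚ (d *ₚ q)
  negₚ-*ₚ = solve-∀ polyRing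

-- Modulo 1 - xᵍ every xᵍʲ is 1, so the geometric sum is s.
oneMinusX-∣-geometric-s : ∀ g s → oneMinusX g ∣ (geometric g s +ₚ negₚ (constₚ (+ s)))
oneMinusX-∣-geometric-s g zero    = divides [] (≋-trans (*ₚ-zeroʳ (oneMinusX g)) (mk≋ λ { zero → refl ; (suc k) → refl }))
oneMinusX-∣-geometric-s g (suc s) = ∣-resp ≋-refl
  (≋-trans (regroup (geometric g s) (xpow (g ℕ.* s)) (constₚ (+ s)))
           (+ₚ-cong ≋-refl (negₚ-cong (≡⇒≋ (cong (λ n → constₚ (+ n)) (ℕ.+-comm s 1))))))
  (∣-+ₚ (oneMinusX-∣-geometric-s g s) (∣-negₚ (oneMinusX-∣ {g} (ℕ.m∣m*n s))))
  where
  regroup : ∀ r x c → ((r +ₚ negₚ c) +ₚ negₚ (oneₚ +ₚ negₚ x)) ≋ ((r +ₚ x) +ₚ negₚ (c +ₚ oneₚ))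
  regroup = solve-∀ polyRing

geometric-Coprime : ∀ g s → 1 ℕ.≤ s → Coprime (geometric g s) (oneMinusX g)
geometric-Coprime g s@(suc _) _ with oneMinusX-∣-geometric-s g s
... | divides v [1-xᵍ]v≋r-s = coprime (+ s) (λ ()) oneₚ (negₚ v) (begin
  (oneₚ *ₚ geometric g s) +ₚ (negₚ v *ₚ oneMinusX g)     ≈⟨ rearrange (geometric g s) v (oneMinusX g) ⟩
  geometric g s +ₚ negₚ (oneMinusX g *ₚ v)              ≈⟨ +ₚ-cong ≋-refl (negₚ-cong [1-xᵍ]v≋r-s) ⟩
  geometric g s +ₚ negₚ (geometric g s +ₚ negₚ (constₚ (+ s)))   ≈⟨ cancel (geometric g s) (constₚ (+ s)) ⟩
  constₚ (+ s)                                          ∎)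
  where
  open ≋-Reasoning
  rearrange : ∀ r v f → ((oneₚ *ₚ r) +ₚ (negₚ v *ₚ f)) ≋ (r +ₚ negₚ (f *ₚ v))
  rearrange = solve-∀ polyRing
  cancel : ∀ r c → (r +ₚ negₚ (r +ₚ negₚ c)) ≋ c
  cancel = solve-∀ polyRing

infix 4 _∈⟨_,_⟩
record _∈⟨_,_⟩ (c a b : Poly) : Set where
  constructor combination
  field
    u v      : Poly
    equality : ((u *ₚ a) +ₚ (v *ₚ b)) ≋ c

∈⟨⟩-swap : ∀ {a b c} → c ∈⟨ a , b ⟩ → c ∈⟨ b , a ⟩
∈⟨⟩-swap {a} {b} (combination u v eq) = combination v u (≋-trans (+ₚ-comm (v *ₚ b) (u *ₚ a)) eq)

oneMinusX-∈ : ∀ {a b d} x y → d ℕ.+ y ℕ.* b ≡ x ℕ.* a → oneMinusX d ∈⟨ oneMinusX a , oneMinusX b ⟩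
oneMinusX-∈ {a} {b} {d} x y d+yb≡xa with oneMinusX-∣ {a} (ℕ.n∣m*n x) | oneMinusX-∣ {b} (ℕ.n∣m*n y)
... | divides α [1-xᵃ]α≋ | divides β [1-xᵇ]β≋ = combination α (negₚ (xpow d *ₚ β)) (begin
  (α *ₚ oneMinusX a) +ₚ (negₚ (xpow d *ₚ β) *ₚ oneMinusX b)
    ≈⟨ rearrange α (oneMinusX a) (xpow d) β (oneMinusX b) ⟩
  (oneMinusX a *ₚ α) +ₚ negₚ (xpow d *ₚ (oneMinusX b *ₚ β))
    ≈⟨ +ₚ-cong [1-xᵃ]α≋ (negₚ-cong (*ₚ-congʳ (xpow d) [1-xᵇ]β≋)) ⟩
  oneMinusX (x ℕ.* a) +ₚ negₚ (xpow d *ₚ oneMinusX (y ℕ.* b))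
    ≡⟨ cong (λ n → oneMinusX n +ₚ negₚ (xpow d *ₚ oneMinusX (y ℕ.* b))) d+yb≡xa ⟨
  oneMinusX (d ℕ.+ y ℕ.* b) +ₚ negₚ (xpow d *ₚ oneMinusX (y ℕ.* b))
    ≈⟨ +ₚ-cong (oneMinusX-+ d (y ℕ.* b)) ≋-refl ⟩
  (oneMinusX d +ₚ (xpow d *ₚ oneMinusX (y ℕ.* b))) +ₚ negₚ (xpow d *ₚ oneMinusX (y ℕ.* b))
    ≈⟨ add-sub (oneMinusX d) (xpow d *ₚ oneMinusX (y ℕ.* b)) ⟩
  oneMinusX d
    ∎)
  where
  open ≋-Reasoning
  rearrange : ∀ α f x β g → ((α *ₚ f) +ₚ (negₚ (x *ₚ β) *ₚ g)) ≋ ((f *ₚ α) +ₚ negₚ (x *ₚ (g *ₚ β)))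
  rearrange = solve-∀ polyRing
  add-sub : ∀ a b → ((a +ₚ b) +ₚ negₚ b) ≋ a
  add-sub = solve-∀ polyRing

oneMinusX-gcd-∈ : ∀ a b → ∃[ d ] d ℕ.∣ a × d ℕ.∣ b × oneMinusX d ∈⟨ oneMinusX a , oneMinusX b ⟩
oneMinusX-gcd-∈ a b with Bézout.lemma a b
... | Bézout.result d gcd (Bézout.+- x y eq) = d , GCD.gcd∣m gcd , GCD.gcd∣n gcd , oneMinusX-∈ x y eq
... | Bézout.result d gcd (Bézout.-+ x y eq) = d , GCD.gcd∣m gcd , GCD.gcd∣n gcd , ∈⟨⟩-swap (oneMinusX-∈ y x eq)

Coprime-∈⟨⟩ : ∀ {a b g x y} → Coprime a g → g ∈⟨ x , y ⟩ → b ∣ x → a ∣ y → Coprime a b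
Coprime-∈⟨⟩ {a} {b} {g} {x} {y} (coprime N N≢0 p q bezout) (combination U W g≋Ux+Wy) (divides α bα≋x) (divides β aβ≋y) =
  coprime N N≢0 (p +ₚ ((q *ₚ W) *ₚ β)) ((q *ₚ U) *ₚ α) (begin
    ((p +ₚ ((q *ₚ W) *ₚ β)) *ₚ a) +ₚ (((q *ₚ U) *ₚ α) *ₚ b)
      ≈⟨ rearrange p q U W α β a b ⟩
    (p *ₚ a) +ₚ (q *ₚ ((U *ₚ (b *ₚ α)) +ₚ (W *ₚ (a *ₚ β))))
      ≈⟨ +ₚ-cong ≋-refl (*ₚ-congʳ q (≋-trans (+ₚ-cong (*ₚ-congʳ U bα≋x) (*ₚ-congʳ W aβ≋y)) g≋Ux+Wy)) ⟩
    (p *ₚ a) +ₚ (q *ₚ g)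
      ≈⟨ bezout ⟩
    constₚ N
      ∎)
  where
  open ≋-Reasoning
  rearrange : ∀ p q U W α β a b → (((p +ₚ ((q *ₚ W) *ₚ β)) *ₚ a) +ₚ (((q *ₚ U) *ₚ α) *ₚ b))
            ≋ ((p *ₚ a) +ₚ (q *ₚ ((U *ₚ (b *ₚ α)) +ₚ (W *ₚ (a *ₚ β)))))
  rearrange = solve-∀ polyRing

AllUpTo : ℕ → (ℕ → Set) → Set
AllUpTo n P = ∀ k → 1 ℕ.≤ k → k ℕ.≤ n → P k

AllUpTo-init : ∀ {n P} → AllUpTo (suc n) P → AllUpTo n P
AllUpTo-init p k 1≤k k≤n = p k 1≤k (ℕ.m≤n⇒m≤1+n k≤n)

AllUpTo-last : ∀ {n P} → AllUpTo (suc n) P → P (suc n)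
AllUpTo-last p = p _ (ℕ.s≤s ℕ.z≤n) ℕ.≤-refl

PairwiseUpTo : ℕ → (ℕ → ℕ → Set) → Set
PairwiseUpTo n R = ∀ j k → 1 ℕ.≤ j → j ℕ.< k → k ℕ.≤ n → R j k

PairwiseUpTo-init : ∀ {n R} → PairwiseUpTo (suc n) R → PairwiseUpTo n R
PairwiseUpTo-init r j k 1≤j j<k k≤n = r j k 1≤j j<k (ℕ.m≤n⇒m≤1+n k≤n)

^ₚ-cong : ∀ {f g} k → f ≋ g → (f ^ₚ k) ≋ (g ^ₚ k)
^ₚ-cong zero    _   = ≋-refl
^ₚ-cong (suc k) f≋g = *ₚ-cong f≋g (^ₚ-cong k f≋g)

^ₚ-+ : ∀ f a b → (f ^ₚ (a ℕ.+ b)) ≋ ((f ^ₚ a) *ₚ (f ^ₚ b))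
^ₚ-+ f zero    b = ≋-sym (*ₚ-identityˡ (f ^ₚ b))
^ₚ-+ f (suc a) b = ≋-trans (*ₚ-congʳ f (^ₚ-+ f a b)) (≋-sym (*ₚ-assoc f (f ^ₚ a) (f ^ₚ b)))

∏ : (ℕ → Poly) → ℕ → (ℕ → ℕ) → Poly
∏ Φ zero    a = oneₚ
∏ Φ (suc n) a = ∏ Φ n a *ₚ (Φ (suc n) ^ₚ a (suc n))

module _ (Φ : ℕ → Poly) where

  ∏-+ : ∀ n a b → (∏ Φ n a *ₚ ∏ Φ n b) ≋ ∏ Φ n (λ k → a k ℕ.+ b k)
  ∏-+ zero    a b = *ₚ-identityˡ oneₚ
  ∏-+ (suc n) a b = ≋-trans (*ₚ-interchange (∏ Φ n a) _ (∏ Φ n b) _)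
    (*ₚ-cong (∏-+ n a b) (≋-sym (^ₚ-+ (Φ (suc n)) (a (suc n)) (b (suc n)))))

  ∏-cong : ∀ n {a b} → AllUpTo n (λ k → a k ≡ b k) → ∏ Φ n a ≋ ∏ Φ n b
  ∏-cong zero    a≡b = ≋-refl
  ∏-cong (suc n) a≡b = *ₚ-cong (∏-cong n (AllUpTo-init a≡b)) (≡⇒≋ (cong (Φ (suc n) ^ₚ_) (AllUpTo-last a≡b)))

  ∏-zero : ∀ n {a} → AllUpTo n (λ k → a k ≡ 0) → ∏ Φ n a ≋ oneₚ
  ∏-zero zero    _   = ≋-refl
  ∏-zero (suc n) a≡0 = ≋-trans (*ₚ-cong (∏-zero n (AllUpTo-init a≡0)) (≡⇒≋ (cong (Φ (suc n) ^ₚ_) (AllUpTo-last a≡0))))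
                               (*ₚ-identityˡ oneₚ)

  ∏-^ₚ : ∀ n a k → (∏ Φ n a ^ₚ k) ≋ ∏ Φ n (λ d → k ℕ.* a d)
  ∏-^ₚ n a zero    = ≋-sym (∏-zero n λ _ _ _ → refl)
  ∏-^ₚ n a (suc k) = ≋-trans (*ₚ-congʳ (∏ Φ n a) (∏-^ₚ n a k)) (∏-+ n a (λ d → k ℕ.* a d))

  ∏-∣ : ∀ n {a b} → AllUpTo n (λ k → a k ℕ.≤ b k) → ∏ Φ n a ∣ ∏ Φ n b
  ∏-∣ n {a} {b} a≤b = divides (∏ Φ n (λ k → b k ℕ.∸ a k))
    (≋-trans (∏-+ n a _) (∏-cong n λ k 1≤k k≤n → ℕ.m+[n∸m]≡n (a≤b k 1≤k k≤n)))

  ∣-∏ : ∀ n {a k} → 1 ℕ.≤ k → k ℕ.≤ n → 1 ℕ.≤ a k → Φ k ∣ ∏ Φ n a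
  ∣-∏ zero    (ℕ.s≤s _) () _
  ∣-∏ (suc n) {a} {k} 1≤k k≤1+n 1≤aₖ with ℕ.m≤n⇒m<n∨m≡n k≤1+n
  ... | inj₁ k<1+n = ∣-*ₚʳ (Φ (suc n) ^ₚ a (suc n)) (∣-∏ n 1≤k (ℕ.≤-pred k<1+n) 1≤aₖ)
  ... | inj₂ refl with a k | 1≤aₖ
  ...   | suc aₖ | _ = ∣-*ₚˡ (∏ Φ n a) (f∣f*ₚg (Φ k) (Φ k ^ₚ aₖ))

  UnitConstant-∏ : ∀ n a → AllUpTo n (UnitConstant ∘ Φ) → UnitConstant (∏ Φ n a)
  UnitConstant-∏ zero    a _    = UnitConstant-oneₚ
  UnitConstant-∏ (suc n) a unit = UnitConstant-*ₚ (UnitConstant-∏ n a (AllUpTo-init unit)) (UnitConstant-^ₚ (a (suc n)) (AllUpTo-last unit))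

  Coprime-∏ : ∀ n {f} a → AllUpTo n (λ k → 1 ℕ.≤ a k → Coprime f (Φ k)) → Coprime f (∏ Φ n a)
  Coprime-∏ zero    {f} a _   = Coprime-oneₚ f
  Coprime-∏ (suc n) {f} a f⊥Φ = Coprime-*ₚ (Coprime-∏ n a (AllUpTo-init f⊥Φ)) last
    where
    last : Coprime f (Φ (suc n) ^ₚ a (suc n))
    last with a (suc n) | AllUpTo-last f⊥Φ
    ... | zero   | _    = Coprime-oneₚ f
    ... | suc aₙ | f⊥Φₙ = Coprime-^ₚ (suc aₙ) (f⊥Φₙ (ℕ.s≤s ℕ.z≤n))

  ∏-∣-squarefree : ∀ n {a F} → AllUpTo n (UnitConstant ∘ Φ) → PairwiseUpTo n (λ j k → Coprime (Φ j) (Φ k))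
                 → AllUpTo n (λ k → a k ℕ.≤ 1) → AllUpTo n (λ k → 1 ℕ.≤ a k → Φ k ∣ F) → ∏ Φ n a ∣ F
  ∏-∣-squarefree zero    {F = F} _ _ _ _ = divides F (*ₚ-identityˡ F)
  ∏-∣-squarefree (suc n) {a} {F} unit pairwise a≤1 Φ∣F = last (a (suc n)) (AllUpTo-last a≤1) (AllUpTo-last Φ∣F)
    where
    IH : ∏ Φ n a ∣ F
    IH = ∏-∣-squarefree n (AllUpTo-init unit) (PairwiseUpTo-init pairwise) (AllUpTo-init a≤1) (AllUpTo-init Φ∣F)
    last : ∀ k → k ℕ.≤ 1 → (1 ℕ.≤ k → Φ (suc n) ∣ F) → (∏ Φ n a *ₚ (Φ (suc n) ^ₚ k)) ∣ F
    last zero          _         _    = ∣-resp (≋-sym (*ₚ-identityʳ _)) ≋-refl IH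
    last (suc zero)    _         Φₙ∣F = ∣-resp (*ₚ-congʳ (∏ Φ n a) (≋-sym (*ₚ-identityʳ (Φ (suc n))))) ≋-refl
      (Coprime-*ₚ-∣ (UnitConstant-∏ n a (AllUpTo-init unit)) (AllUpTo-last unit) IH (Φₙ∣F (ℕ.s≤s ℕ.z≤n))
        (Coprime-sym (Coprime-∏ n a λ k 1≤k k≤n _ → Coprime-sym (pairwise k (suc n) 1≤k (ℕ.s≤s k≤n) ℕ.≤-refl))))
    last (suc (suc _)) (ℕ.s≤s ()) _

-- Cyclotomic polynomials

[_∣_] : ℕ → ℕ → ℕ
[ d ∣ m ] with d ℕ.∣? m
... | yes _ = 1
... | no  _ = 0

[∣]-yes : ∀ {d m} → d ℕ.∣ m → [ d ∣ m ] ≡ 1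
[∣]-yes {d} {m} d∣m with d ℕ.∣? m
... | yes _   = refl
... | no  d∤m = ⊥-elim (d∤m d∣m)

[∣]-no : ∀ {d m} → ¬ d ℕ.∣ m → [ d ∣ m ] ≡ 0
[∣]-no {d} {m} d∤m with d ℕ.∣? m
... | yes d∣m = ⊥-elim (d∤m d∣m)
... | no  _   = refl

[∣]-≤1 : ∀ d m → [ d ∣ m ] ℕ.≤ 1
[∣]-≤1 d m with d ℕ.∣? m
... | yes _ = ℕ.≤-refl
... | no  _ = ℕ.z≤n

[∣]-pos : ∀ {d m} → 1 ℕ.≤ [ d ∣ m ] → d ℕ.∣ m
[∣]-pos {d} {m} 1≤[d∣m] with d ℕ.∣? m
... | yes d∣m = d∣m

[∣]-mono : ∀ {m m′} d → m ℕ.∣ m′ → [ d ∣ m ] ℕ.≤ [ d ∣ m′ ]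
[∣]-mono {m} {m′} d m∣m′ with d ℕ.∣? m
... | yes d∣m = ℕ.≤-reflexive (sym ([∣]-yes (ℕ.∣-trans d∣m m∣m′)))
... | no  _   = ℕ.z≤n

[∣]-large : ∀ {d m} → 1 ℕ.≤ m → m ℕ.< d → [ d ∣ m ] ≡ 0
[∣]-large {m = suc _} _ m<d = [∣]-no (ℕ.>⇒∤ m<d)

UnitConstant-oneMinusX : ∀ m → 1 ℕ.≤ m → UnitConstant (oneMinusX m)
UnitConstant-oneMinusX (suc m) _ = unitConstant (+ 1) refl

-- Φ d plays the role of the d-th cyclotomic polynomial, normalised to constant term ±1.
record CyclotomicFamily (K : ℕ) (Φ : ℕ → Poly) : Set where
  field
    factorisation    : ∀ m → 1 ℕ.≤ m → m ℕ.≤ K → oneMinusX m ≋ ∏ Φ K [_∣ m ]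
    pairwise-Coprime : PairwiseUpTo K (λ j k → Coprime (Φ j) (Φ k))

  Φ∣oneMinusX : AllUpTo K (λ d → Φ d ∣ oneMinusX d)
  Φ∣oneMinusX d 1≤d d≤K = ∣-resp ≋-refl (≋-sym (factorisation d 1≤d d≤K))
    (∣-∏ Φ K 1≤d d≤K (ℕ.≤-reflexive (sym ([∣]-yes (ℕ.∣-refl {d})))))

  UnitConstant-Φ : AllUpTo K (UnitConstant ∘ Φ)
  UnitConstant-Φ d 1≤d d≤K = ∣-UnitConstant (Φ∣oneMinusX d 1≤d d≤K) (UnitConstant-oneMinusX d 1≤d)

-- The next member is Φ M = (1 - xᴹ) / ∏_{d ∣ M, d < M} Φ d.
module Extension {K Φ} (family : CyclotomicFamily K Φ) where
  open CyclotomicFamily family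

  M : ℕ
  M = suc K

  properDivisorPart : Poly
  properDivisorPart = ∏ Φ K [_∣ M ]

  properDivisorPart-∣ : properDivisorPart ∣ oneMinusX M
  properDivisorPart-∣ = ∏-∣-squarefree Φ K UnitConstant-Φ pairwise-Coprime (λ d _ _ → [∣]-≤1 d M)
    λ d 1≤d d≤K 1≤[d∣M] → ∣-trans (Φ∣oneMinusX d 1≤d d≤K) (oneMinusX-∣ ([∣]-pos 1≤[d∣M]))

  Φₘ : Poly
  Φₘ = quotient properDivisorPart-∣

  Φ′ : ℕ → Poly
  Φ′ d with d ℕ.≤? K
  ... | yes _ = Φ d
  ... | no  _ = Φₘ

  Φ′-old : ∀ {d} → d ℕ.≤ K → Φ′ d ≋ Φ d
  Φ′-old {d} d≤K with d ℕ.≤? K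
  ... | yes _   = ≋-refl
  ... | no  d≰K = ⊥-elim (d≰K d≤K)

  Φ′-new : Φ′ M ≋ Φₘ
  Φ′-new with M ℕ.≤? K
  ... | yes M≤K = ⊥-elim (ℕ.<-irrefl refl M≤K)
  ... | no  _   = ≋-refl

  ∏Φ′≋∏Φ : ∀ a → ∏ Φ′ K a ≋ ∏ Φ K a
  ∏Φ′≋∏Φ a = go K ℕ.≤-refl
    where
    go : ∀ n → n ℕ.≤ K → ∏ Φ′ n a ≋ ∏ Φ n a
    go zero    _      = ≋-refl
    go (suc n) 1+n≤K = *ₚ-cong (go n (ℕ.<⇒≤ 1+n≤K)) (^ₚ-cong (a (suc n)) (Φ′-old 1+n≤K))

  factorisation′ : ∀ m → 1 ℕ.≤ m → m ℕ.≤ M → oneMinusX m ≋ ∏ Φ′ M [_∣ m ]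
  factorisation′ m 1≤m m≤M with ℕ.m≤n⇒m<n∨m≡n m≤M
  ... | inj₁ m<M = begin
    oneMinusX m                               ≈⟨ factorisation m 1≤m (ℕ.≤-pred m<M) ⟩
    ∏ Φ K [_∣ m ]                             ≈⟨ *ₚ-identityʳ _ ⟨
    ∏ Φ K [_∣ m ] *ₚ oneₚ                     ≡⟨ cong (λ k → ∏ Φ K [_∣ m ] *ₚ (Φ′ M ^ₚ k)) ([∣]-large 1≤m m<M) ⟨
    ∏ Φ K [_∣ m ] *ₚ (Φ′ M ^ₚ [ M ∣ m ])      ≈⟨ *ₚ-congˡ _ (∏Φ′≋∏Φ [_∣ m ]) ⟨
    ∏ Φ′ M [_∣ m ]                            ∎
    where open ≋-Reasoning
  ... | inj₂ refl = begin
    oneMinusX M                               ≈⟨ equality properDivisorPart-∣ ⟨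
    properDivisorPart *ₚ Φₘ                   ≈⟨ *ₚ-cong (∏Φ′≋∏Φ [_∣ M ]) (≋-trans (*ₚ-identityʳ (Φ′ M)) Φ′-new) ⟨
    ∏ Φ′ K [_∣ M ] *ₚ (Φ′ M ^ₚ 1)
      ≡⟨ cong (λ k → ∏ Φ′ K [_∣ M ] *ₚ (Φ′ M ^ₚ k)) ([∣]-yes (ℕ.∣-refl {M})) ⟨
    ∏ Φ′ M [_∣ M ]                            ∎
    where open ≋-Reasoning

  Φₘ∣oneMinusX : Φₘ ∣ oneMinusX M
  Φₘ∣oneMinusX = divides properDivisorPart (≋-trans (*ₚ-comm Φₘ _) (equality properDivisorPart-∣))

  -- The divisors of d split off properDivisorPart as 1 - xᵈ, so Φₘ is left dividing (1 - xᴹ) / (1 - xᵈ).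
  Φₘ∣geometric : ∀ {d q} → 1 ℕ.≤ d → d ℕ.≤ K → M ≡ d ℕ.* q → Φₘ ∣ geometric d q
  Φₘ∣geometric {d} {q} 1≤d d≤K M≡dq = divides T (*ₚ-cancelˡ (UnitConstant-oneMinusX d 1≤d) (begin
    oneMinusX d *ₚ (Φₘ *ₚ T)            ≈⟨ rotate (oneMinusX d) Φₘ T ⟩
    (oneMinusX d *ₚ T) *ₚ Φₘ            ≈⟨ *ₚ-congˡ Φₘ split ⟨
    properDivisorPart *ₚ Φₘ             ≈⟨ equality properDivisorPart-∣ ⟩
    oneMinusX M                         ≡⟨ cong oneMinusX M≡dq ⟩
    oneMinusX (d ℕ.* q)                 ≈⟨ oneMinusX-* d q ⟩
    oneMinusX d *ₚ geometric d q        ∎))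
    where
    open ≋-Reasoning
    T : Poly
    T = ∏ Φ K (λ e → [ e ∣ M ] ℕ.∸ [ e ∣ d ])
    split : properDivisorPart ≋ (oneMinusX d *ₚ T)
    split = ≋-sym (≋-trans (*ₚ-congˡ T (factorisation d 1≤d d≤K))
      (≋-trans (∏-+ Φ K _ _) (∏-cong Φ K λ e _ _ → ℕ.m+[n∸m]≡n ([∣]-mono e (ℕ.divides q (trans M≡dq (ℕ.*-comm d q)))))))
    rotate : ∀ a b c → (a *ₚ (b *ₚ c)) ≋ ((a *ₚ c) *ₚ b)
    rotate = solve-∀ polyRing

  -- With d = gcd(a, M): 1 - xᵈ lies in the ideal of 1 - xᵃ and 1 - xᴹ,
  -- while (1 - xᴹ) / (1 - xᵈ) ≡ M / d modulo 1 - xᵈ.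
  Φₘ-Coprime : AllUpTo K (λ a → Coprime (Φ a) Φₘ)
  Φₘ-Coprime a 1≤a a≤K with oneMinusX-gcd-∈ a M
  ... | d , d∣a , ℕ.divides q M≡qd , gcd∈ =
    Coprime-sym (Coprime-∈⟨⟩ (Coprime-∣ˡ (Φₘ∣geometric 1≤d d≤K M≡dq) (geometric-Coprime d q 1≤q))
                             gcd∈ (Φ∣oneMinusX a 1≤a a≤K) Φₘ∣oneMinusX)
    where
    M≡dq : M ≡ d ℕ.* q
    M≡dq = trans M≡qd (ℕ.*-comm q d)
    1≤d : 1 ℕ.≤ d
    1≤d = ℕ.n≢0⇒n>0 λ { refl → ℕ.n>0⇒n≢0 1≤a (ℕ.0∣⇒≡0 d∣a) }
    d≤K : d ℕ.≤ K
    d≤K = ℕ.≤-trans (ℕ.∣⇒≤ ⦃ ℕ.>-nonZero 1≤a ⦄ d∣a) a≤K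
    1≤q : 1 ℕ.≤ q
    1≤q = ℕ.n≢0⇒n>0 λ { refl → ℕ.1+n≢0 (trans M≡dq (ℕ.*-zeroʳ d)) }

  pairwise-Coprime′ : PairwiseUpTo M (λ j k → Coprime (Φ′ j) (Φ′ k))
  pairwise-Coprime′ j k 1≤j j<k k≤M with ℕ.m≤n⇒m<n∨m≡n k≤M
  ... | inj₁ k<M  = Coprime-resp (≋-sym (Φ′-old (ℕ.≤-trans (ℕ.<⇒≤ j<k) (ℕ.≤-pred k<M)))) (≋-sym (Φ′-old (ℕ.≤-pred k<M)))
                                 (pairwise-Coprime j k 1≤j j<k (ℕ.≤-pred k<M))
  ... | inj₂ refl = Coprime-resp (≋-sym (Φ′-old (ℕ.≤-pred j<k))) (≋-sym Φ′-new) (Φₘ-Coprime j 1≤j (ℕ.≤-pred j<k))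

  extended : CyclotomicFamily M Φ′
  extended = record { factorisation = factorisation′ ; pairwise-Coprime = pairwise-Coprime′ }

cyclotomicFamily : ∀ K → Σ (ℕ → Poly) (CyclotomicFamily K)
cyclotomicFamily zero    = (λ _ → oneₚ) , record
  { factorisation    = λ { (suc _) _ () }
  ; pairwise-Coprime = λ { _ _ _ (ℕ.s≤s _) () } }
cyclotomicFamily (suc K) = let open Extension (proj₂ (cyclotomicFamily K)) in Φ′ , extended

∑ : ℕ → (ℕ → ℕ) → ℕ
∑ zero    f = 0
∑ (suc n) f = ∑ n f ℕ.+ f (suc n)

∑-cong : ∀ n {f g} → AllUpTo n (λ i → f i ≡ g i) → ∑ n f ≡ ∑ n g
∑-cong zero    _   = refl
∑-cong (suc n) f≡g = cong₂ ℕ._+_ (∑-cong n (AllUpTo-init f≡g)) (AllUpTo-last f≡g)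

∑-zero : ∀ n {f} → AllUpTo n (λ i → f i ≡ 0) → ∑ n f ≡ 0
∑-zero zero    _   = refl
∑-zero (suc n) f≡0 = cong₂ ℕ._+_ (∑-zero n (AllUpTo-init f≡0)) (AllUpTo-last f≡0)

∑-≥ : ∀ n f {j} → 1 ℕ.≤ j → j ℕ.≤ n → f j ℕ.≤ ∑ n f
∑-≥ zero    f (ℕ.s≤s _) ()
∑-≥ (suc n) f {j} 1≤j j≤1+n with ℕ.m≤n⇒m<n∨m≡n j≤1+n
... | inj₁ j<1+n = ℕ.≤-trans (∑-≥ n f 1≤j (ℕ.≤-pred j<1+n)) (ℕ.m≤m+n (∑ n f) _)
... | inj₂ refl  = ℕ.m≤n+m (f j) (∑ n f)

-- GCD criterion

-- The exponents are lowered from g + B to g one index j at a time: the running divisibility is combined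
-- with e ∣ ∏ Φ (b j), which is exact at j, their cofactors Φ j ^ B j and ∏_{d<j} Φ d ^ B d being coprime.
module GcdCriterion {L Φ} (family : CyclotomicFamily L Φ) {e : Poly} (g : ℕ → ℕ) (b : ℕ → ℕ → ℕ)
                    (b-diagonal : AllUpTo L (λ j → b j j ≡ g j))
                    (e∣ℚ∏b : AllUpTo L (λ j → e ∣ℚ ∏ Φ L (b j))) where
  open CyclotomicFamily family

  B : ℕ → ℕ
  B d = ∑ L (λ j → b j d)

  raised : ℕ → ℕ → ℕ
  raised j d with d ℕ.≤? j
  ... | yes _ = g d
  ... | no  _ = g d ℕ.+ B d

  atStep : ℕ → ℕ → ℕ
  atStep j d with d ℕ.≟ suc j
  ... | yes _ = B d
  ... | no  _ = 0

  below : ℕ → ℕ → ℕ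
  below j d with d ℕ.≤? j
  ... | yes _ = B d
  ... | no  _ = 0

  raised-split : ∀ j d → raised j d ≡ atStep j d ℕ.+ raised (suc j) d
  raised-split j d with d ℕ.≤? j | d ℕ.≟ suc j | d ℕ.≤? suc j
  ... | yes d≤j | yes refl  | _         = ⊥-elim (ℕ.<-irrefl refl d≤j)
  ... | yes _   | no  _     | yes _     = refl
  ... | yes d≤j | no  _     | no  d≰1+j = ⊥-elim (d≰1+j (ℕ.m≤n⇒m≤1+n d≤j))
  ... | no  _   | yes refl  | yes _     = ℕ.+-comm (g d) (B d)
  ... | no  _   | yes refl  | no  d≰1+j = ⊥-elim (d≰1+j ℕ.≤-refl)
  ... | no  d≰j | no  d≢1+j | yes d≤1+j = ⊥-elim (d≢1+j (ℕ.≤-antisym d≤1+j (ℕ.≰⇒> d≰j)))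
  ... | no  _   | no  _     | no  _     = refl

  b≤below+raised : ∀ j → j ℕ.< L → AllUpTo L (λ d → b (suc j) d ℕ.≤ below j d ℕ.+ raised (suc j) d)
  b≤below+raised j j<L d 1≤d d≤L with d ℕ.≤? j | d ℕ.≤? suc j
  ... | yes _   | _         = ℕ.≤-trans (∑-≥ L (λ j → b j d) (ℕ.s≤s ℕ.z≤n) j<L) (ℕ.m≤m+n (B d) _)
  ... | no  _   | no  _     = ℕ.≤-trans (∑-≥ L (λ j → b j d) (ℕ.s≤s ℕ.z≤n) j<L) (ℕ.m≤n+m (B d) (g d))
  ... | no  d≰j | yes d≤1+j rewrite ℕ.≤-antisym d≤1+j (ℕ.≰⇒> d≰j) = ℕ.≤-reflexive (b-diagonal (suc j) (ℕ.s≤s ℕ.z≤n) j<L)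

  Coprime-atStep-below : ∀ j → j ℕ.< L → Coprime (∏ Φ L (atStep j)) (∏ Φ L (below j))
  Coprime-atStep-below j j<L = Coprime-∏ Φ L (below j) λ k 1≤k k≤L 1≤belowₖ →
    Coprime-sym (Coprime-∏ Φ L (atStep j) λ d 1≤d d≤L 1≤atStepᵈ →
      pairwise-Coprime k d 1≤k (ℕ.≤-trans (ℕ.s≤s (below-≤ k 1≤belowₖ)) (ℕ.≤-reflexive (sym (atStep-≡ d 1≤atStepᵈ)))) d≤L)
    where
    below-≤ : ∀ k → 1 ℕ.≤ below j k → k ℕ.≤ j
    below-≤ k 1≤belowₖ with k ℕ.≤? j
    ... | yes k≤j = k≤j
    atStep-≡ : ∀ d → 1 ℕ.≤ atStep j d → d ≡ suc j
    atStep-≡ d 1≤atStepᵈ with d ℕ.≟ suc j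
    ... | yes d≡1+j = d≡1+j

  raised-step : ∀ j → j ℕ.< L → e ∣ℚ ∏ Φ L (raised j) → e ∣ℚ ∏ Φ L (raised (suc j))
  raised-step j j<L e∣ℚraised = ∣ℚ-cancel-Coprime
    (∣ℚ-respʳ (≋-sym (≋-trans (∏-+ Φ L _ _) (∏-cong Φ L λ d _ _ → sym (raised-split j d)))) e∣ℚraised)
    (∣ℚ-∣-trans (e∣ℚ∏b (suc j) (ℕ.s≤s ℕ.z≤n) j<L)
                (∣-resp ≋-refl (≋-sym (∏-+ Φ L _ _)) (∏-∣ Φ L (b≤below+raised j j<L))))
    (Coprime-atStep-below j j<L)

  raised-start : 1 ℕ.≤ L → e ∣ℚ ∏ Φ L (raised 0)
  raised-start 1≤L = ∣ℚ-∣-trans (e∣ℚ∏b 1 ℕ.≤-refl 1≤L) (∏-∣ Φ L b₁≤raised₀)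
    where
    b₁≤raised₀ : AllUpTo L (λ d → b 1 d ℕ.≤ raised 0 d)
    b₁≤raised₀ d@(suc _) _ _ = ℕ.≤-trans (∑-≥ L (λ j → b j d) ℕ.≤-refl 1≤L) (ℕ.m≤n+m (B d) (g d))

  raised-up-to : 1 ℕ.≤ L → ∀ j → j ℕ.≤ L → e ∣ℚ ∏ Φ L (raised j)
  raised-up-to 1≤L zero    _     = raised-start 1≤L
  raised-up-to 1≤L (suc j) 1+j≤L = raised-step j 1+j≤L (raised-up-to 1≤L j (ℕ.<⇒≤ 1+j≤L))

  e∣ℚ∏g : 1 ℕ.≤ L → e ∣ℚ ∏ Φ L g
  e∣ℚ∏g 1≤L = ∣ℚ-respʳ (∏-cong Φ L raised-L) (raised-up-to 1≤L L ℕ.≤-refl)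
    where
    raised-L : AllUpTo L (λ d → raised L d ≡ g d)
    raised-L d _ d≤L with d ℕ.≤? L
    ... | yes _   = refl
    ... | no  d≰L = ⊥-elim (d≰L d≤L)

-- The binary logarithm ⌊log₂(n/i)⌋

n<2^n : ∀ n → n ℕ.< 2 ℕ.^ n
n<2^n zero    = ℕ.s≤s ℕ.z≤n
n<2^n (suc n) = ℕ.+-mono-≤ (ℕ.m^n>0 2 n) (ℕ.≤-trans (n<2^n n) (ℕ.m≤m+n _ 0))

*2^-mono : ∀ i {a b} → a ℕ.≤ b → i ℕ.* 2 ℕ.^ a ℕ.≤ i ℕ.* 2 ℕ.^ b
*2^-mono i a≤b = ℕ.*-monoʳ-≤ i (ℕ.^-monoʳ-≤ 2 a≤b)

log2Search : (i n fuel k : ℕ) → ℕ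
log2Search i n zero    k = k
log2Search i n (suc f) k = if i ℕ.* 2 ℕ.^ suc k ℕ.≤ᵇ n then log2Search i n f (suc k) else k

fuel-induction : {R : ℕ → ℕ → Set} → (∀ k → R zero k) → (∀ f k → R f (suc k) → R (suc f) k) → ∀ f k → R f k
fuel-induction     base step zero    k = base k
fuel-induction {R} base step (suc f) k = step f k (fuel-induction {R} base step f (suc k))

mutual
  -- The left-hand side is the search loop local to flog2 in Defs, which cannot be named here;
  -- generalising bound and accumulator at the use below lets unification fill it in.
  flog2-loop≡log2Search : ∀ n i f k → _ ≡ log2Search i n f k
  flog2-loop≡log2Search n i = fuel-induction (λ _ → refl) (λ f k → cong (λ r → if i ℕ.* 2 ℕ.^ suc k ℕ.≤ᵇ n then r else k))

  flog2≡log2Search : ∀ n i → flog2 n i ≡ log2Search i n n 0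
  flog2≡log2Search zero    i = refl
  flog2≡log2Search (suc m) i with i ℕ.* 2 ℕ.^ 1 ℕ.≤ᵇ suc m
  ... | false = refl
  ... | true with suc m | 1
  ...   | n | k = flog2-loop≡log2Search n i m k

log2Search-spec : ∀ i n f k → 1 ℕ.≤ i → f ℕ.+ k ≡ n → i ℕ.* 2 ℕ.^ k ℕ.≤ n →
                  i ℕ.* 2 ℕ.^ log2Search i n f k ℕ.≤ n × n ℕ.< i ℕ.* 2 ℕ.^ suc (log2Search i n f k)
log2Search-spec i n zero    k 1≤i refl i2ᵏ≤n =
  ⊥-elim (ℕ.<-irrefl refl (ℕ.<-≤-trans (n<2^n k) (ℕ.≤-trans (ℕ.m≤n*m (2 ℕ.^ k) i ⦃ ℕ.>-nonZero 1≤i ⦄) i2ᵏ≤n)))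
log2Search-spec i n (suc f) k 1≤i f+k≡n i2ᵏ≤n with i ℕ.* 2 ℕ.^ suc k ℕ.≤ᵇ n | ℕ.≤ᵇ-reflects-≤ (i ℕ.* 2 ℕ.^ suc k) n
... | true  | ofʸ i2ᵏ⁺¹≤n = log2Search-spec i n f (suc k) 1≤i (trans (ℕ.+-suc f k) f+k≡n) i2ᵏ⁺¹≤n
... | false | ofⁿ i2ᵏ⁺¹≰n = i2ᵏ≤n , ℕ.≰⇒> i2ᵏ⁺¹≰n

flog2-spec : ∀ {n i} → 1 ℕ.≤ i → i ℕ.≤ n → i ℕ.* 2 ℕ.^ flog2 n i ℕ.≤ n × n ℕ.< i ℕ.* 2 ℕ.^ suc (flog2 n i)
flog2-spec {n} {i} 1≤i i≤n rewrite flog2≡log2Search n i =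
  log2Search-spec i n n 0 1≤i (ℕ.+-identityʳ n) (subst (ℕ._≤ n) (sym (ℕ.*-identityʳ i)) i≤n)

*2^-exponent-≤ : ∀ i {n a b} → i ℕ.* 2 ℕ.^ a ℕ.≤ n → n ℕ.< i ℕ.* 2 ℕ.^ suc b → a ℕ.≤ b
*2^-exponent-≤ i {a = a} {b} lower upper with a ℕ.≤? b
... | yes a≤b = a≤b
... | no  a≰b = ⊥-elim (ℕ.<-irrefl refl (ℕ.<-≤-trans upper (ℕ.≤-trans (*2^-mono i (ℕ.≰⇒> a≰b)) lower)))

flog2-unique : ∀ {n i} a → 1 ℕ.≤ i → i ℕ.* 2 ℕ.^ a ℕ.≤ n → n ℕ.< i ℕ.* 2 ℕ.^ suc a → flog2 n i ≡ a
flog2-unique {n} {i} a 1≤i lower upper =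
  ℕ.≤-antisym (*2^-exponent-≤ i (proj₁ spec) upper) (*2^-exponent-≤ i lower (proj₂ spec))
  where
  spec = flog2-spec 1≤i (ℕ.≤-trans (ℕ.m≤m*n i (2 ℕ.^ a) ⦃ ℕ.>-nonZero (ℕ.m^n>0 2 a) ⦄) lower)

flog2-small : ∀ {n i} → n ℕ.< i ℕ.* 2 → flog2 n i ≡ 0
flog2-small {zero}  _ = refl
flog2-small {suc m} {i} 1+m<2i rewrite flog2≡log2Search (suc m) i
  with i ℕ.* 2 ℕ.^ 1 ℕ.≤ᵇ suc m | ℕ.≤ᵇ-reflects-≤ (i ℕ.* 2 ℕ.^ 1) (suc m)
... | false | _            = refl
... | true  | ofʸ 2i≤1+m =
  ⊥-elim (ℕ.<-irrefl refl (ℕ.<-≤-trans 1+m<2i (subst (ℕ._≤ suc m) (cong (i ℕ.*_) (ℕ.*-identityʳ 2)) 2i≤1+m)))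

-- Positivity and monotonicity of c

n<[1+n/d]*d : ∀ n d → n ℕ.< suc (n ℕ./ suc d) ℕ.* suc d
n<[1+n/d]*d n d = subst (ℕ._< suc (n ℕ./ suc d) ℕ.* suc d) (sym (ℕ.m≡m%n+[m/n]*n n (suc d)))
  (ℕ.+-monoˡ-< (n ℕ./ suc d ℕ.* suc d) (ℕ.m%n<n n (suc d)))

*≤⇒≤/ : ∀ q n d → q ℕ.* suc d ℕ.≤ n → q ℕ.≤ n ℕ./ suc d
*≤⇒≤/ q n d q*d≤n = ℕ.≮⇒≥ λ n/d<q →
  ℕ.<-irrefl refl (ℕ.<-≤-trans (n<[1+n/d]*d n d) (ℕ.≤-trans (ℕ.*-monoˡ-≤ (suc d) n/d<q) q*d≤n))

flog2-/ : ∀ {n} i → suc i ℕ.≤ n → flog2 n (suc i) ≡ flog2 (n ℕ./ suc i) 1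
flog2-/ {n} i 1+i≤n = flog2-unique a (ℕ.s≤s ℕ.z≤n) lower upper
  where
  q = n ℕ./ suc i
  a = flog2 q 1
  spec = flog2-spec {q} ℕ.≤-refl (*≤⇒≤/ 1 n i (subst (ℕ._≤ n) (sym (ℕ.*-identityˡ (suc i))) 1+i≤n))
  lower : suc i ℕ.* 2 ℕ.^ a ℕ.≤ n
  lower = ℕ.≤-trans (ℕ.≤-reflexive (ℕ.*-comm (suc i) _))
    (ℕ.≤-trans (ℕ.*-monoˡ-≤ (suc i) (subst (ℕ._≤ q) (ℕ.*-identityˡ _) (proj₁ spec))) (ℕ.m/n*n≤m n (suc i)))
  upper : n ℕ.< suc i ℕ.* 2 ℕ.^ suc a
  upper = ℕ.<-≤-trans (n<[1+n/d]*d n i)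
    (ℕ.≤-trans (ℕ.*-monoˡ-≤ (suc i) (subst (q ℕ.<_) (ℕ.*-identityˡ _) (proj₂ spec))) (ℕ.≤-reflexive (ℕ.*-comm _ (suc i))))

c₁ : ℕ → ℕ
c₁ q = q ℕ.∸ flog2 q 1 ℕ.∸ 1

c≡c₁ : ∀ {n} i → suc i ℕ.≤ n → c n (suc i) ≡ c₁ (n ℕ./ suc i)
c≡c₁ {n} i 1+i≤n = cong (λ L → n ℕ./ suc i ℕ.∸ L ℕ.∸ 1) (flog2-/ i 1+i≤n)

-- ⌊log₂⌋ grows by at most one from q to q + 1.
c₁-suc : ∀ q → 1 ℕ.≤ q → c₁ q ℕ.≤ c₁ (suc q)
c₁-suc q 1≤q = ℕ.∸-monoˡ-≤ {q ℕ.∸ flog2 q 1} {suc q ℕ.∸ flog2 (suc q) 1} 1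
  (ℕ.∸-monoʳ-≤ {flog2 (suc q) 1} {suc (flog2 q 1)} (suc q) (*2^-exponent-≤ 1 (proj₁ spec′) q+1<2^L+2))
  where
  spec  = flog2-spec {q} ℕ.≤-refl 1≤q
  spec′ = flog2-spec {suc q} ℕ.≤-refl (ℕ.s≤s ℕ.z≤n)
  q+1<2^L+2 : suc q ℕ.< 1 ℕ.* 2 ℕ.^ suc (suc (flog2 q 1))
  q+1<2^L+2 = ℕ.<-≤-trans (ℕ.s≤s (proj₂ spec))
    (ℕ.*-monoʳ-≤ 1 {suc (2 ℕ.^ suc (flog2 q 1))} (ℕ.^-monoʳ-< 2 (ℕ.s≤s (ℕ.s≤s ℕ.z≤n)) (ℕ.n<1+n (suc (flog2 q 1)))))

c₁-mono : ∀ {q q′} → 1 ℕ.≤ q → q ℕ.≤ q′ → c₁ q ℕ.≤ c₁ q′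
c₁-mono {q} {zero}   1≤q q≤0 = ⊥-elim (ℕ.<-irrefl refl (ℕ.≤-trans 1≤q q≤0))
c₁-mono {q} {suc q′} 1≤q q≤1+q′ with ℕ.m≤n⇒m<n∨m≡n q≤1+q′
... | inj₂ refl          = ℕ.≤-refl
... | inj₁ (ℕ.s≤s q≤q′) = ℕ.≤-trans (c₁-mono 1≤q q≤q′) (c₁-suc q′ (ℕ.≤-trans 1≤q q≤q′))

n+2≤2^n : ∀ n → 2 ℕ.≤ n → n ℕ.+ 2 ℕ.≤ 2 ℕ.^ n
n+2≤2^n 1 (ℕ.s≤s ())
n+2≤2^n 2 _ = ℕ.≤-refl
n+2≤2^n (suc (suc (suc n))) _ =
  ℕ.+-mono-≤ (ℕ.m^n>0 2 (suc (suc n))) (ℕ.≤-trans (n+2≤2^n (suc (suc n)) (ℕ.s≤s (ℕ.s≤s ℕ.z≤n))) (ℕ.m≤m+n _ 0))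

c₁-pos : ∀ q → 3 ℕ.≤ q → 1 ℕ.≤ c₁ q
c₁-pos q 3≤q = subst (1 ℕ.≤_) (sym (ℕ.∸-+-assoc q (flog2 q 1) 1)) (ℕ.m<n⇒0<n∸m L+2≤q)
  where
  L = flog2 q 1
  L+2≤q : suc (L ℕ.+ 1) ℕ.≤ q
  L+2≤q with L ℕ.≤? 1
  ... | yes L≤1 = ℕ.≤-trans (ℕ.s≤s (ℕ.+-monoˡ-≤ 1 L≤1)) 3≤q
  ... | no  L≰1 = subst (ℕ._≤ q) (ℕ.+-suc L 1) (ℕ.≤-trans (n+2≤2^n L (ℕ.≰⇒> L≰1)) 2^L≤q)
    where
    2^L≤q : 2 ℕ.^ L ℕ.≤ q
    2^L≤q = subst (ℕ._≤ q) (ℕ.*-identityˡ _) (proj₁ (flog2-spec {q} ℕ.≤-refl (ℕ.≤-trans (ℕ.s≤s ℕ.z≤n) 3≤q)))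

c-pos : ∀ n i → 1 ℕ.≤ i → i ℕ.≤ divℕ n 3 → 0 ℕ.< c n i
c-pos n (suc i) _ 1+i≤n/3 = subst (1 ℕ.≤_) (sym (c≡c₁ i 1+i≤n))
  (c₁-pos (n ℕ./ suc i) (*≤⇒≤/ 3 n i (ℕ.≤-trans (ℕ.≤-reflexive (ℕ.*-comm 3 (suc i))) 3[1+i]≤n)))
  where
  3[1+i]≤n : suc i ℕ.* 3 ℕ.≤ n
  3[1+i]≤n = ℕ.≤-trans (ℕ.*-monoˡ-≤ 3 1+i≤n/3) (ℕ.m/n*n≤m n 3)
  1+i≤n : suc i ℕ.≤ n
  1+i≤n = ℕ.≤-trans (ℕ.m≤m*n (suc i) 3) 3[1+i]≤n

c-mono : ∀ n i j → 1 ℕ.≤ i → i ℕ.≤ j → j ℕ.≤ n → c n j ℕ.≤ c n i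
c-mono n (suc i) (suc j) _ i≤j j≤n = subst₂ ℕ._≤_ (sym (c≡c₁ j j≤n)) (sym (c≡c₁ i (ℕ.≤-trans i≤j j≤n)))
  (c₁-mono (*≤⇒≤/ 1 n j (subst (ℕ._≤ n) (sym (ℕ.*-identityˡ (suc j))) j≤n)) (ℕ./-monoʳ-≤ n i≤j))

-- Counting multiples of d along dyadic chains

δ : ℕ → ℕ → ℕ
δ a b = if a ℕ.≡ᵇ b then 1 else 0

δ-refl : ∀ a → δ a a ≡ 1
δ-refl a with a ℕ.≡ᵇ a | ℕ.≡⇒≡ᵇ a a refl
... | true | _ = refl

δ-≢ : ∀ {a b} → a ≢ b → δ a b ≡ 0
δ-≢ {a} {b} a≢b with a ℕ.≡ᵇ b | ℕ.≡ᵇ⇒≡ a b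
... | true  | a≡b = ⊥-elim (a≢b (a≡b _))
... | false | _   = refl

δ-sym : ∀ a b → δ a b ≡ δ b a
δ-sym a b with a ℕ.≟ b
... | yes refl = refl
... | no  a≢b  = trans (δ-≢ a≢b) (sym (δ-≢ (a≢b ∘ sym)))

∑-+ : ∀ n f g → ∑ n (λ i → f i ℕ.+ g i) ≡ ∑ n f ℕ.+ ∑ n g
∑-+ zero    f g = refl
∑-+ (suc n) f g = trans (cong (ℕ._+ (f (suc n) ℕ.+ g (suc n))) (∑-+ n f g)) (interchange (∑ n f) (∑ n g) _ _)
  where
  interchange : ∀ a b c d → a ℕ.+ b ℕ.+ (c ℕ.+ d) ≡ a ℕ.+ c ℕ.+ (b ℕ.+ d)
  interchange = ℕ-Solver.solve-∀

∑-δ : ∀ n (s : ℕ → ℕ) {p} → 1 ℕ.≤ p → p ℕ.≤ n → ∑ n (λ i → s i ℕ.* δ i p) ≡ s p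
∑-δ zero    s (ℕ.s≤s _) ()
∑-δ (suc n) s {p} 1≤p p≤1+n with ℕ.m≤n⇒m<n∨m≡n p≤1+n
... | inj₁ (ℕ.s≤s p≤n) = begin
  ∑ n (λ i → s i ℕ.* δ i p) ℕ.+ s (suc n) ℕ.* δ (suc n) p
    ≡⟨ cong₂ ℕ._+_ (∑-δ n s 1≤p p≤n) (cong (s (suc n) ℕ.*_) (δ-≢ λ 1+n≡p → ℕ.<-irrefl (sym 1+n≡p) (ℕ.s≤s p≤n))) ⟩
  s p ℕ.+ s (suc n) ℕ.* 0                                   ≡⟨ cong (s p ℕ.+_) (ℕ.*-zeroʳ (s (suc n))) ⟩
  s p ℕ.+ 0                                                 ≡⟨ ℕ.+-identityʳ (s p) ⟩
  s p                                                       ∎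
  where open ≡-Reasoning
... | inj₂ refl = begin
  ∑ n (λ i → s i ℕ.* δ i p) ℕ.+ s p ℕ.* δ p p
    ≡⟨ cong₂ ℕ._+_ (∑-zero n λ i _ i≤n → trans (cong (s i ℕ.*_) (δ-≢ λ i≡p → ℕ.<-irrefl i≡p (ℕ.s≤s i≤n))) (ℕ.*-zeroʳ (s i)))
                   (cong (s p ℕ.*_) (δ-refl p)) ⟩
  0 ℕ.+ s p ℕ.* 1                                ≡⟨ ℕ.*-identityʳ (s p) ⟩
  s p                                           ∎
  where open ≡-Reasoning

*2^suc : ∀ i k → i ℕ.* 2 ℕ.^ suc k ≡ 2 ℕ.* (i ℕ.* 2 ℕ.^ k)
*2^suc i k = trans (sym (ℕ.*-assoc i 2 _)) (trans (cong (ℕ._* 2 ℕ.^ k) (ℕ.*-comm i 2)) (ℕ.*-assoc 2 i _))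

n<2*n : ∀ {n} → 1 ℕ.≤ n → n ℕ.< 2 ℕ.* n
n<2*n {suc n} _ = ℕ.m<m+n (suc n) (ℕ.s≤s ℕ.z≤n)

flog2-self : ∀ n → 1 ℕ.≤ n → flog2 n n ≡ 0
flog2-self n 1≤n = flog2-small (subst (n ℕ.<_) (ℕ.*-comm 2 n) (n<2*n 1≤n))

-- dyadic m i is 1 exactly when m = i·2ᵏ for some k, necessarily k = ⌊log₂(m/i)⌋.
dyadic : ℕ → ℕ → ℕ
dyadic m i = δ (i ℕ.* 2 ℕ.^ flog2 m i) m

-- chainLength n i counts the k with i·2ᵏ ≤ n.
chainLength : ℕ → ℕ → ℕ
chainLength n i with i ℕ.≤? n
... | yes _ = suc (flog2 n i)
... | no  _ = 0

chainLength-≤ : ∀ {n i} → i ℕ.≤ n → chainLength n i ≡ suc (flog2 n i)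
chainLength-≤ {n} {i} i≤n with i ℕ.≤? n
... | yes _   = refl
... | no  i≰n = ⊥-elim (i≰n i≤n)

chainLength-suc-≤ : ∀ n i → 1 ℕ.≤ i → i ℕ.≤ n → suc (flog2 (suc n) i) ≡ suc (flog2 n i) ℕ.+ dyadic (suc n) i
chainLength-suc-≤ n i 1≤i i≤n with i ℕ.* 2 ℕ.^ suc (flog2 n i) ℕ.≟ suc n
... | yes i2ᴸ⁺¹≡1+n = begin
  suc (flog2 (suc n) i)                       ≡⟨ cong suc L′≡L+1 ⟩
  suc (suc L)                                 ≡⟨ ℕ.+-comm 1 (suc L) ⟩
  suc L ℕ.+ 1                                 ≡⟨ cong (suc L ℕ.+_) (trans (cong (λ k → δ (i ℕ.* 2 ℕ.^ k) (suc n)) L′≡L+1)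
                                                   (trans (cong (λ m → δ m (suc n)) i2ᴸ⁺¹≡1+n) (δ-refl (suc n)))) ⟨
  suc L ℕ.+ dyadic (suc n) i                  ∎
  where
  open ≡-Reasoning
  L = flog2 n i
  L′≡L+1 : flog2 (suc n) i ≡ suc L
  L′≡L+1 = flog2-unique (suc L) 1≤i (ℕ.≤-reflexive i2ᴸ⁺¹≡1+n)
    (subst (suc n ℕ.<_) (sym (trans (*2^suc i (suc L)) (cong (2 ℕ.*_) i2ᴸ⁺¹≡1+n))) (n<2*n (ℕ.s≤s ℕ.z≤n)))
... | no  i2ᴸ⁺¹≢1+n = begin
  suc (flog2 (suc n) i)                       ≡⟨ cong suc L′≡L ⟩
  suc L                                       ≡⟨ ℕ.+-identityʳ (suc L) ⟨
  suc L ℕ.+ 0                                 ≡⟨ cong (suc L ℕ.+_) (trans (cong (λ k → δ (i ℕ.* 2 ℕ.^ k) (suc n)) L′≡L)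
                                                   (δ-≢ λ i2ᴸ≡1+n → ℕ.<-irrefl i2ᴸ≡1+n (ℕ.s≤s (proj₁ spec)))) ⟨
  suc L ℕ.+ dyadic (suc n) i                  ∎
  where
  open ≡-Reasoning
  L = flog2 n i
  spec = flog2-spec 1≤i i≤n
  L′≡L : flog2 (suc n) i ≡ L
  L′≡L = flog2-unique L 1≤i (ℕ.m≤n⇒m≤1+n (proj₁ spec)) (ℕ.≤∧≢⇒< (proj₂ spec) (i2ᴸ⁺¹≢1+n ∘ sym))

chainLength-suc : ∀ n i → 1 ℕ.≤ i → chainLength (suc n) i ≡ chainLength n i ℕ.+ dyadic (suc n) i
chainLength-suc n i 1≤i with i ℕ.≤? suc n | i ℕ.≤? n
... | yes _     | yes i≤n = chainLength-suc-≤ n i 1≤i i≤n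
... | yes i≤1+n | no  i≰n rewrite ℕ.≤-antisym i≤1+n (ℕ.≰⇒> i≰n) | flog2-self (suc n) (ℕ.s≤s ℕ.z≤n) =
  sym (trans (cong (λ m → δ m (suc n)) (ℕ.*-identityʳ (suc n))) (δ-refl (suc n)))
... | no  i≰1+n | yes i≤n = ⊥-elim (i≰1+n (ℕ.m≤n⇒m≤1+n i≤n))
... | no  i≰1+n | no  _   rewrite flog2-small {suc n} {i} (ℕ.<-≤-trans (ℕ.≰⇒> i≰1+n) (ℕ.m≤m*n i 2)) =
  sym (δ-≢ λ i*1≡1+n → i≰1+n (ℕ.≤-reflexive (trans (sym (ℕ.*-identityʳ i)) i*1≡1+n)))

δ-*2 : ∀ a b → δ (2 ℕ.* a) (2 ℕ.* b) ≡ δ a b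
δ-*2 a b with a ℕ.≟ b
... | yes refl = trans (δ-refl (2 ℕ.* a)) (sym (δ-refl a))
... | no  a≢b  = trans (δ-≢ λ 2a≡2b → a≢b (ℕ.*-cancelˡ-≡ a b 2 2a≡2b)) (sym (δ-≢ a≢b))

dyadic-even : ∀ h i → 1 ℕ.≤ i → dyadic (2 ℕ.* h) i ≡ δ i (2 ℕ.* h) ℕ.+ dyadic h i
dyadic-even h i 1≤i with i ℕ.≤? h
... | yes i≤h = begin
  δ (i ℕ.* 2 ℕ.^ flog2 (2 ℕ.* h) i) (2 ℕ.* h)      ≡⟨ cong (λ k → δ (i ℕ.* 2 ℕ.^ k) (2 ℕ.* h)) L′≡L+1 ⟩
  δ (i ℕ.* 2 ℕ.^ suc L) (2 ℕ.* h)                  ≡⟨ cong (λ m → δ m (2 ℕ.* h)) (*2^suc i L) ⟩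
  δ (2 ℕ.* (i ℕ.* 2 ℕ.^ L)) (2 ℕ.* h)              ≡⟨ δ-*2 (i ℕ.* 2 ℕ.^ L) h ⟩
  dyadic h i
    ≡⟨ cong (ℕ._+ dyadic h i) (δ-≢ λ i≡2h → ℕ.<-irrefl i≡2h (ℕ.≤-<-trans i≤h (n<2*n (ℕ.≤-trans 1≤i i≤h)))) ⟨
  δ i (2 ℕ.* h) ℕ.+ dyadic h i                     ∎
  where
  open ≡-Reasoning
  L = flog2 h i
  spec = flog2-spec 1≤i i≤h
  L′≡L+1 : flog2 (2 ℕ.* h) i ≡ suc L
  L′≡L+1 = flog2-unique (suc L) 1≤i (subst (ℕ._≤ 2 ℕ.* h) (sym (*2^suc i L)) (ℕ.*-monoʳ-≤ 2 (proj₁ spec)))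
                                    (subst (2 ℕ.* h ℕ.<_) (sym (*2^suc i (suc L))) (ℕ.*-monoʳ-< 2 (proj₂ spec)))
... | no  i≰h rewrite flog2-small {h} {i} (ℕ.<-≤-trans (ℕ.≰⇒> i≰h) (ℕ.m≤m*n i 2))
                    | flog2-small {2 ℕ.* h} {i} (subst (2 ℕ.* h ℕ.<_) (ℕ.*-comm 2 i) (ℕ.*-monoʳ-< 2 (ℕ.≰⇒> i≰h)))
                    | ℕ.*-identityʳ i
  = sym (trans (cong (δ i (2 ℕ.* h) ℕ.+_) (δ-≢ λ i≡h → i≰h (ℕ.≤-reflexive i≡h))) (ℕ.+-identityʳ _))

1+2m<2n : ∀ {m n} → m ℕ.< n → suc (2 ℕ.* m) ℕ.< 2 ℕ.* n
1+2m<2n {m} m<n = ℕ.≤-trans (ℕ.s≤s (ℕ.≤-reflexive (sym (ℕ.+-suc m (m ℕ.+ 0))))) (ℕ.*-monoʳ-≤ 2 m<n)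

dyadic-odd : ∀ h i → 1 ℕ.≤ i → dyadic (suc (2 ℕ.* h)) i ≡ δ i (suc (2 ℕ.* h))
dyadic-odd h i 1≤i with i ℕ.≤? h
... | yes i≤h = trans (odd≢even (flog2 m i) refl)
                      (sym (δ-≢ λ i≡m → ℕ.<-irrefl i≡m (ℕ.s≤s (ℕ.≤-trans i≤h (ℕ.m≤m+n h _)))))
  where
  m = suc (2 ℕ.* h)
  spec = flog2-spec {m} 1≤i (ℕ.≤-trans i≤h (ℕ.≤-trans (ℕ.m≤m+n h _) (ℕ.n≤1+n _)))
  -- 2i ≤ 2h < m forces a positive exponent, and then i·2ᴸ is even.
  odd≢even : ∀ L → flog2 m i ≡ L → dyadic m i ≡ 0
  odd≢even zero    L≡0 = ⊥-elim (ℕ.<-irrefl refl (ℕ.<-≤-trans (subst (λ k → m ℕ.< i ℕ.* 2 ℕ.^ suc k) L≡0 (proj₂ spec))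
    (ℕ.≤-trans (ℕ.≤-reflexive (trans (*2^suc i 0) (cong (2 ℕ.*_) (ℕ.*-identityʳ i)))) (ℕ.≤-trans (ℕ.*-monoʳ-≤ 2 i≤h) (ℕ.n≤1+n _)))))
  odd≢even (suc L) L≡1+L rewrite L≡1+L = δ-≢ λ e → ℕ.even≢odd (i ℕ.* 2 ℕ.^ L) h (trans (sym (*2^suc i L)) e)
... | no  i≰h rewrite flog2-small {suc (2 ℕ.* h)} {i} (subst (suc (2 ℕ.* h) ℕ.<_) (ℕ.*-comm 2 i) (1+2m<2n (ℕ.≰⇒> i≰h)))
                    | ℕ.*-identityʳ i = refl

parity : ∀ m → ∃[ h ] (m ≡ 2 ℕ.* h ⊎ m ≡ suc (2 ℕ.* h))
parity zero    = 0 , inj₁ refl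
parity (suc m) with parity m
... | h , inj₁ m≡2h   = h , inj₂ (cong suc m≡2h)
... | h , inj₂ m≡1+2h = suc h , inj₁ (trans (cong suc m≡1+2h) (cong suc (sym (ℕ.+-suc h (h ℕ.+ 0)))))

[∣]-*2 : ∀ d h → [ 2 ℕ.* d ∣ 2 ℕ.* h ] ≡ [ d ∣ h ]
[∣]-*2 d h with d ℕ.∣? h
... | yes d∣h = [∣]-yes (ℕ.*-monoʳ-∣ 2 d∣h)
... | no  d∤h = [∣]-no λ 2d∣2h → d∤h (ℕ.*-cancelˡ-∣ 2 2d∣2h)

2*d∤odd : ∀ d h → ¬ 2 ℕ.* d ℕ.∣ suc (2 ℕ.* h)
2*d∤odd d h (ℕ.divides q 1+2h≡q2d) = ℕ.even≢odd (q ℕ.* d) h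
  (sym (trans 1+2h≡q2d (trans (sym (ℕ.*-assoc q 2 d)) (trans (cong (ℕ._* d) (ℕ.*-comm q 2)) (ℕ.*-assoc 2 q d)))))

-- oddMultiple d i is 1 exactly when i / d is an odd integer.
oddMultiple : ℕ → ℕ → ℕ
oddMultiple d i = [ d ∣ i ] ℕ.∸ [ 2 ℕ.* d ∣ i ]

oddMultiple-even : ∀ d h → oddMultiple d (2 ℕ.* h) ℕ.+ [ d ∣ h ] ≡ [ d ∣ 2 ℕ.* h ]
oddMultiple-even d h rewrite [∣]-*2 d h with d ℕ.∣? h
... | yes d∣h rewrite [∣]-yes {d} {2 ℕ.* h} (ℕ.∣-trans d∣h (ℕ.n∣m*n 2)) = refl
... | no  _   = ℕ.+-identityʳ _

oddMultiple-odd : ∀ d h → oddMultiple d (suc (2 ℕ.* h)) ≡ [ d ∣ suc (2 ℕ.* h) ]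
oddMultiple-odd d h rewrite [∣]-no (2*d∤odd d h) = refl

∑-oddMultiple-dyadic : ∀ B d m → 1 ℕ.≤ m → m ℕ.≤ B → ∑ B (λ i → oddMultiple d i ℕ.* dyadic m i) ≡ [ d ∣ m ]
∑-oddMultiple-dyadic B d = <-rec _ step
  where
  step : ∀ m → (∀ {h} → h ℕ.< m → 1 ℕ.≤ h → h ℕ.≤ B → ∑ B (λ i → oddMultiple d i ℕ.* dyadic h i) ≡ [ d ∣ h ])
       → 1 ℕ.≤ m → m ℕ.≤ B → ∑ B (λ i → oddMultiple d i ℕ.* dyadic m i) ≡ [ d ∣ m ]
  step m rec 1≤m m≤B with parity m
  ... | h , inj₁ refl = begin
    ∑ B (λ i → oddMultiple d i ℕ.* dyadic (2 ℕ.* h) i)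
      ≡⟨ ∑-cong B (λ i 1≤i _ → trans (cong (oddMultiple d i ℕ.*_) (dyadic-even h i 1≤i)) (ℕ.*-distribˡ-+ (oddMultiple d i) _ _)) ⟩
    ∑ B (λ i → oddMultiple d i ℕ.* δ i (2 ℕ.* h) ℕ.+ oddMultiple d i ℕ.* dyadic h i)
      ≡⟨ ∑-+ B _ _ ⟩
    ∑ B (λ i → oddMultiple d i ℕ.* δ i (2 ℕ.* h)) ℕ.+ ∑ B (λ i → oddMultiple d i ℕ.* dyadic h i)
      ≡⟨ cong₂ ℕ._+_ (∑-δ B (oddMultiple d) 1≤m m≤B) (rec (n<2*n 1≤h) 1≤h (ℕ.≤-trans (ℕ.m≤m+n h _) m≤B)) ⟩
    oddMultiple d (2 ℕ.* h) ℕ.+ [ d ∣ h ]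
      ≡⟨ oddMultiple-even d h ⟩
    [ d ∣ 2 ℕ.* h ]
      ∎
    where
    open ≡-Reasoning
    1≤h : 1 ℕ.≤ h
    1≤h = ℕ.n≢0⇒n>0 λ { refl → ℕ.<-irrefl refl 1≤m }
  ... | h , inj₂ refl = trans (∑-cong B λ i 1≤i _ → cong (oddMultiple d i ℕ.*_) (dyadic-odd h i 1≤i))
                              (trans (∑-δ B (oddMultiple d) 1≤m m≤B) (oddMultiple-odd d h))

/-unique : ∀ {n d q} → q ℕ.* suc d ℕ.≤ n → n ℕ.< suc q ℕ.* suc d → n ℕ./ suc d ≡ q
/-unique {n} {d} {q} lower upper = ℕ.≤-antisym (ℕ.≤-pred (ℕ.m<n*o⇒m/o<n upper)) (*≤⇒≤/ q n d lower)

/-suc : ∀ n d → suc n ℕ./ suc d ≡ n ℕ./ suc d ℕ.+ [ suc d ∣ suc n ]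
/-suc n d with suc d ℕ.∣? suc n
... | yes (ℕ.divides (suc k) 1+n≡[1+k][1+d]) = begin
  suc n ℕ./ suc d                   ≡⟨ cong (ℕ._/ suc d) 1+n≡[1+k][1+d] ⟩
  suc k ℕ.* suc d ℕ./ suc d         ≡⟨ ℕ.m*n/n≡m (suc k) (suc d) ⟩
  suc k                             ≡⟨ ℕ.+-comm 1 k ⟩
  k ℕ.+ 1                           ≡⟨ cong (ℕ._+ 1) (/-unique k*d≤n n<[1+k]*d) ⟨
  n ℕ./ suc d ℕ.+ 1                 ∎
  where
  open ≡-Reasoning
  n<[1+k]*d : n ℕ.< suc k ℕ.* suc d
  n<[1+k]*d = ℕ.≤-reflexive 1+n≡[1+k][1+d]
  k*d≤n : k ℕ.* suc d ℕ.≤ n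
  k*d≤n = ℕ.≤-pred (ℕ.<-≤-trans (ℕ.*-monoˡ-< (suc d) (ℕ.n<1+n k)) (ℕ.≤-reflexive (sym 1+n≡[1+k][1+d])))
... | yes (ℕ.divides zero ())
... | no  d∤1+n = trans (/-unique (ℕ.≤-trans (ℕ.m/n*n≤m n (suc d)) (ℕ.n≤1+n n))
                                   (ℕ.≤∧≢⇒< (n<[1+n/d]*d n d) λ 1+n≡ → d∤1+n (ℕ.divides (suc (n ℕ./ suc d)) 1+n≡)))
                        (sym (ℕ.+-identityʳ _))

-- Each multiple of d up to n is uniquely i·2ᵏ with i / d odd.
∑-oddMultiple-chainLength : ∀ B d n → n ℕ.≤ B → ∑ B (λ i → oddMultiple (suc d) i ℕ.* chainLength n i) ≡ n ℕ./ suc d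
∑-oddMultiple-chainLength B d zero    _ = ∑-zero B λ i 1≤i _ →
  trans (cong (oddMultiple (suc d) i ℕ.*_) (chainLength-0 i 1≤i)) (ℕ.*-zeroʳ (oddMultiple (suc d) i))
  where
  chainLength-0 : ∀ i → 1 ℕ.≤ i → chainLength 0 i ≡ 0
  chainLength-0 (suc i) _ = refl
∑-oddMultiple-chainLength B d (suc n) 1+n≤B = begin
  ∑ B (λ i → S i ℕ.* chainLength (suc n) i)
    ≡⟨ ∑-cong B (λ i 1≤i _ → trans (cong (S i ℕ.*_) (chainLength-suc n i 1≤i)) (ℕ.*-distribˡ-+ (S i) _ _)) ⟩
  ∑ B (λ i → S i ℕ.* chainLength n i ℕ.+ S i ℕ.* dyadic (suc n) i)
    ≡⟨ ∑-+ B _ _ ⟩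
  ∑ B (λ i → S i ℕ.* chainLength n i) ℕ.+ ∑ B (λ i → S i ℕ.* dyadic (suc n) i)
    ≡⟨ cong₂ ℕ._+_ (∑-oddMultiple-chainLength B d n (ℕ.<⇒≤ 1+n≤B))
                   (∑-oddMultiple-dyadic B (suc d) (suc n) (ℕ.s≤s ℕ.z≤n) 1+n≤B) ⟩
  n ℕ./ suc d ℕ.+ [ suc d ∣ suc n ]
    ≡⟨ /-suc n d ⟨
  suc n ℕ./ suc d
    ∎
  where
  open ≡-Reasoning
  S = oddMultiple (suc d)

mult-∷ : ∀ p λs i → mult (p ∷ λs) i ≡ δ p i ℕ.+ mult λs i
mult-∷ p λs i with p ℕ.≡ᵇ i
... | true  = refl
... | false = refl

i*mult≤sum : ∀ λs i → i ℕ.* mult λs i ℕ.≤ sum λs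
i*mult≤sum []       i = ℕ.≤-reflexive (ℕ.*-zeroʳ i)
i*mult≤sum (p ∷ λs) i rewrite mult-∷ p λs i with p ℕ.≟ i
... | yes refl rewrite δ-refl p = ℕ.≤-trans (ℕ.≤-reflexive (ℕ.*-suc p (mult λs p))) (ℕ.+-monoʳ-≤ p (i*mult≤sum λs p))
... | no  p≢i  rewrite δ-≢ p≢i  = ℕ.≤-trans (i*mult≤sum λs i) (ℕ.m≤n+m (sum λs) p)

mult≤divℕ : ∀ {n λs} i → 1 ℕ.≤ i → IsPartition n λs → mult λs i ℕ.≤ divℕ n i
mult≤divℕ {n} {λs} (suc i) _ (_ , _ , refl) =
  *≤⇒≤/ (mult λs (suc i)) (sum λs) i (ℕ.≤-trans (ℕ.≤-reflexive (ℕ.*-comm (mult λs (suc i)) (suc i))) (i*mult≤sum λs (suc i)))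

partsBetween1and : ∀ {n λs} → IsPartition n λs → All (λ p → 1 ℕ.≤ p × p ℕ.≤ n) λs
partsBetween1and (_ , positive , refl) = go positive
  where
  go : ∀ {λs} → All (0 ℕ.<_) λs → All (λ p → 1 ℕ.≤ p × p ℕ.≤ sum λs) λs
  go All.[]                        = All.[]
  go {p ∷ λs} (1≤p All.∷ positive) =
    (1≤p , ℕ.m≤m+n p (sum λs)) All.∷ All.map (λ (1≤q , q≤Σ) → 1≤q , ℕ.≤-trans q≤Σ (ℕ.m≤n+m (sum λs) p)) (go positive)

∑-mult : ∀ n (s : ℕ → ℕ) λs → All (λ p → 1 ℕ.≤ p × p ℕ.≤ n) λs → ∑ n (λ i → mult λs i ℕ.* s i) ≡ sum (map s λs)
∑-mult n s []       All.[]                 = ∑-zero n λ _ _ _ → refl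
∑-mult n s (p ∷ λs) ((1≤p , p≤n) All.∷ ps) = begin
  ∑ n (λ i → mult (p ∷ λs) i ℕ.* s i)
    ≡⟨ ∑-cong n (λ i _ _ → trans (cong (ℕ._* s i) (mult-∷ p λs i))
                           (trans (ℕ.*-distribʳ-+ (s i) (δ p i) _) (cong (ℕ._+ mult λs i ℕ.* s i) (ℕ.*-comm (δ p i) (s i))))) ⟩
  ∑ n (λ i → s i ℕ.* δ p i ℕ.+ mult λs i ℕ.* s i)
    ≡⟨ ∑-+ n _ _ ⟩
  ∑ n (λ i → s i ℕ.* δ p i) ℕ.+ ∑ n (λ i → mult λs i ℕ.* s i)
    ≡⟨ cong₂ ℕ._+_ (trans (∑-cong n λ i _ _ → cong (s i ℕ.*_) (δ-sym p i)) (∑-δ n s 1≤p p≤n)) (∑-mult n s λs ps) ⟩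
  s p ℕ.+ sum (map s λs)
    ∎
  where open ≡-Reasoning

-- Exponents of the cyclotomic factors

odd∣2*⇒∣ : ∀ i d → suc (2 ℕ.* d) ℕ.∣ 2 ℕ.* i → suc (2 ℕ.* d) ℕ.∣ i
odd∣2*⇒∣ i d (ℕ.divides q 2i≡q[1+2d]) with parity q
... | h , inj₁ refl = ℕ.divides h (ℕ.*-cancelˡ-≡ i _ 2 (trans 2i≡q[1+2d] (ℕ.*-assoc 2 h _)))
... | h , inj₂ refl = ⊥-elim (ℕ.even≢odd i (h ℕ.* suc (2 ℕ.* d) ℕ.+ d) (trans 2i≡q[1+2d] (odd*odd h d)))
  where
  odd*odd : ∀ h d → suc (2 ℕ.* h) ℕ.* suc (2 ℕ.* d) ≡ suc (2 ℕ.* (h ℕ.* suc (2 ℕ.* d) ℕ.+ d))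
  odd*odd = ℕ-Solver.solve-∀

-- Φ e occurs in 1 + xⁱ = (1 - x²ⁱ) / (1 - xⁱ) exactly this often.
onePlusX-exponent : ℕ → ℕ → ℕ
onePlusX-exponent i e = [ e ∣ 2 ℕ.* i ] ℕ.∸ [ e ∣ i ]

onePlusX-exponent-even : ∀ i d → onePlusX-exponent i (2 ℕ.* d) ≡ oddMultiple d i
onePlusX-exponent-even i d = cong (ℕ._∸ [ 2 ℕ.* d ∣ i ]) ([∣]-*2 d i)

onePlusX-exponent-odd : ∀ i d → onePlusX-exponent i (suc (2 ℕ.* d)) ≡ 0
onePlusX-exponent-odd i d with suc (2 ℕ.* d) ℕ.∣? i
... | yes e∣i rewrite [∣]-yes (ℕ.∣-trans e∣i (ℕ.n∣m*n 2)) = refl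
... | no  e∤i rewrite [∣]-no (e∤i ∘ odd∣2*⇒∣ i d) = refl

-- the exponent of Φ e in ∏_{i ≤ n} (1 + xⁱ)^(f i)
exponent : ℕ → (ℕ → ℕ) → ℕ → ℕ
exponent n f e = ∑ n (λ i → f i ℕ.* onePlusX-exponent i e)

exponent-odd : ∀ n f h → exponent n f (suc (2 ℕ.* h)) ≡ 0
exponent-odd n f h = ∑-zero n λ i _ _ → trans (cong (f i ℕ.*_) (onePlusX-exponent-odd i h)) (ℕ.*-zeroʳ (f i))

exponent-even : ∀ n f d → exponent n f (2 ℕ.* d) ≡ ∑ n (λ i → f i ℕ.* oddMultiple d i)
exponent-even n f d = ∑-cong n λ i _ _ → cong (f i ℕ.*_) (onePlusX-exponent-even i d)

c+chainLength≡divℕ : ∀ {n} i → 1 ℕ.≤ i → i ℕ.≤ n → c n i ℕ.+ chainLength n i ≡ divℕ n i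
c+chainLength≡divℕ {n} (suc i) 1≤i i≤n = begin
  c n (suc i) ℕ.+ chainLength n (suc i)              ≡⟨ cong (c n (suc i) ℕ.+_) (chainLength-≤ i≤n) ⟩
  n ℕ./ suc i ℕ.∸ L ℕ.∸ 1 ℕ.+ suc L                  ≡⟨ cong (ℕ._+ suc L) (ℕ.∸-+-assoc (n ℕ./ suc i) L 1) ⟩
  n ℕ./ suc i ℕ.∸ (L ℕ.+ 1) ℕ.+ suc L                ≡⟨ cong (λ k → n ℕ./ suc i ℕ.∸ k ℕ.+ suc L) (ℕ.+-comm L 1) ⟩
  n ℕ./ suc i ℕ.∸ suc L ℕ.+ suc L                    ≡⟨ ℕ.m∸n+n≡m 1+L≤n/i ⟩
  n ℕ./ suc i                                        ∎
  where
  open ≡-Reasoning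
  L = flog2 n (suc i)
  1+L≤n/i : suc L ℕ.≤ n ℕ./ suc i
  1+L≤n/i = *≤⇒≤/ (suc L) n i (ℕ.≤-trans (ℕ.*-monoˡ-≤ (suc i) (n<2^n L))
              (ℕ.≤-trans (ℕ.≤-reflexive (ℕ.*-comm (2 ℕ.^ L) (suc i))) (proj₁ (flog2-spec 1≤i i≤n))))

∑-c-oddMultiple : ∀ n d → ∑ n (λ i → c n i ℕ.* oddMultiple (suc d) i) ℕ.+ n ℕ./ suc d
                        ≡ ∑ n (λ i → divℕ n i ℕ.* oddMultiple (suc d) i)
∑-c-oddMultiple n d = begin
  ∑ n (λ i → c n i ℕ.* S i) ℕ.+ n ℕ./ suc d
    ≡⟨ cong (∑ n (λ i → c n i ℕ.* S i) ℕ.+_) (∑-oddMultiple-chainLength n d n ℕ.≤-refl) ⟨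
  ∑ n (λ i → c n i ℕ.* S i) ℕ.+ ∑ n (λ i → S i ℕ.* chainLength n i)
    ≡⟨ ∑-+ n _ _ ⟨
  ∑ n (λ i → c n i ℕ.* S i ℕ.+ S i ℕ.* chainLength n i)
    ≡⟨ ∑-cong n (λ i 1≤i i≤n → trans (cong (c n i ℕ.* S i ℕ.+_) (ℕ.*-comm (S i) (chainLength n i)))
                                (trans (sym (ℕ.*-distribʳ-+ (S i) (c n i) _)) (cong (ℕ._* S i) (c+chainLength≡divℕ i 1≤i i≤n)))) ⟩
  ∑ n (λ i → divℕ n i ℕ.* S i)
    ∎
  where
  open ≡-Reasoning
  S = oddMultiple (suc d)

∑-h-oddMultiple : ∀ {n λs} d → IsPartition n λs →
                  ∑ n (λ i → (divℕ n i ℕ.∸ mult λs i) ℕ.* oddMultiple d i) ℕ.+ sum (map (oddMultiple d) λs)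
                                                ≡ ∑ n (λ i → divℕ n i ℕ.* oddMultiple d i)
∑-h-oddMultiple {n} {λs} d partition = begin
  ∑ n (λ i → (divℕ n i ℕ.∸ mult λs i) ℕ.* S i) ℕ.+ sum (map S λs)
    ≡⟨ cong (∑ n (λ i → (divℕ n i ℕ.∸ mult λs i) ℕ.* S i) ℕ.+_) (∑-mult n S λs (partsBetween1and partition)) ⟨
  ∑ n (λ i → (divℕ n i ℕ.∸ mult λs i) ℕ.* S i) ℕ.+ ∑ n (λ i → mult λs i ℕ.* S i)
    ≡⟨ ∑-+ n _ _ ⟨
  ∑ n (λ i → (divℕ n i ℕ.∸ mult λs i) ℕ.* S i ℕ.+ mult λs i ℕ.* S i)
    ≡⟨ ∑-cong n (λ i 1≤i _ → trans (sym (ℕ.*-distribʳ-+ (S i) (divℕ n i ℕ.∸ mult λs i) _))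
                                   (cong (ℕ._* S i) (ℕ.m∸n+n≡m (mult≤divℕ i 1≤i partition)))) ⟩
  ∑ n (λ i → divℕ n i ℕ.* S i)
    ∎
  where
  open ≡-Reasoning
  S = oddMultiple d

*[∣]≤ : ∀ d {p} → 1 ℕ.≤ p → d ℕ.* [ d ∣ p ] ℕ.≤ p
*[∣]≤ d {p} 1≤p with d ℕ.∣? p
... | yes d∣p = subst (ℕ._≤ p) (sym (ℕ.*-identityʳ d)) (ℕ.∣⇒≤ ⦃ ℕ.>-nonZero 1≤p ⦄ d∣p)
... | no  _   = subst (ℕ._≤ p) (sym (ℕ.*-zeroʳ d)) ℕ.z≤n

-- A part contributes to the count of odd multiples of d only if it is at least d.
oddParts≤ : ∀ {n λs} d → IsPartition n λs → sum (map (oddMultiple (suc d)) λs) ℕ.≤ n ℕ./ suc d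
oddParts≤ {λs = λs} d (_ , positive , refl) =
  *≤⇒≤/ _ (sum λs) d (ℕ.≤-trans (ℕ.≤-reflexive (ℕ.*-comm _ (suc d))) (go λs positive))
  where
  d*S≤p : ∀ p → 1 ℕ.≤ p → suc d ℕ.* oddMultiple (suc d) p ℕ.≤ p
  d*S≤p p 1≤p = ℕ.≤-trans (ℕ.*-monoʳ-≤ (suc d) (ℕ.m∸n≤m [ suc d ∣ p ] [ 2 ℕ.* suc d ∣ p ])) (*[∣]≤ (suc d) 1≤p)
  go : ∀ λs → All (0 ℕ.<_) λs → suc d ℕ.* sum (map (oddMultiple (suc d)) λs) ℕ.≤ sum λs
  go []       All.[]             = ℕ.≤-reflexive (ℕ.*-zeroʳ (suc d))
  go (p ∷ λs) (1≤p All.∷ positive) =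
    ℕ.≤-trans (ℕ.≤-reflexive (ℕ.*-distribˡ-+ (suc d) (oddMultiple (suc d) p) (sum (map (oddMultiple (suc d)) λs))))
              (ℕ.+-mono-≤ (d*S≤p p 1≤p) (go λs positive))

-- the partition with the most parts that are odd multiples of d + 1
extremal : ℕ → ℕ → List ℕ
extremal n d = replicate (n ℕ./ suc d) (suc d) ++ replicate (n ℕ.% suc d) 1

replicate-++-decreasing : ∀ q r x → 1 ℕ.≤ x → Linked ℕ._≥_ (replicate q x ++ replicate r 1)
replicate-++-decreasing zero          zero    x _   = Linked.[]
replicate-++-decreasing zero          (suc r) x _   = Linked.map (λ 1≥1 → 1≥1) (replicate-decreasing (suc r))
  where
  replicate-decreasing : ∀ r → Linked ℕ._≥_ (replicate r 1)
  replicate-decreasing zero          = Linked.[]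
  replicate-decreasing (suc zero)    = Linked.[-]
  replicate-decreasing (suc (suc r)) = ℕ.≤-refl Linked.∷ replicate-decreasing (suc r)
replicate-++-decreasing (suc zero)    zero    x _   = Linked.[-]
replicate-++-decreasing (suc zero)    (suc r) x 1≤x = 1≤x Linked.∷ replicate-++-decreasing zero (suc r) x 1≤x
replicate-++-decreasing (suc (suc q)) r       x 1≤x = ℕ.≤-refl Linked.∷ replicate-++-decreasing (suc q) r x 1≤x

sum-replicate : ∀ q x → sum (replicate q x) ≡ q ℕ.* x
sum-replicate zero    x = refl
sum-replicate (suc q) x = cong (x ℕ.+_) (sum-replicate q x)

extremal-IsPartition : ∀ n d → IsPartition n (extremal n d)
extremal-IsPartition n d =
  replicate-++-decreasing (n ℕ./ suc d) (n ℕ.% suc d) (suc d) (ℕ.s≤s ℕ.z≤n) ,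
  All.++⁺ (All.replicate⁺ (n ℕ./ suc d) (ℕ.s≤s ℕ.z≤n)) (All.replicate⁺ (n ℕ.% suc d) (ℕ.s≤s ℕ.z≤n)) ,
  (begin
    sum (extremal n d)                                   ≡⟨ ℕ.sum-++ (replicate (n ℕ./ suc d) (suc d)) _ ⟩
    sum (replicate (n ℕ./ suc d) (suc d)) ℕ.+ sum (replicate (n ℕ.% suc d) 1)
      ≡⟨ cong₂ ℕ._+_ (sum-replicate (n ℕ./ suc d) (suc d)) (trans (sum-replicate (n ℕ.% suc d) 1) (ℕ.*-identityʳ (n ℕ.% suc d))) ⟩
    n ℕ./ suc d ℕ.* suc d ℕ.+ n ℕ.% suc d                ≡⟨ ℕ.+-comm _ (n ℕ.% suc d) ⟩
    n ℕ.% suc d ℕ.+ n ℕ./ suc d ℕ.* suc d                ≡⟨ ℕ.m≡m%n+[m/n]*n n (suc d) ⟨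
    n                                                    ∎)
  where open ≡-Reasoning

oddParts-extremal : ∀ n d → sum (map (oddMultiple (suc d)) (extremal n d)) ≡ n ℕ./ suc d
oddParts-extremal n d = begin
  sum (map S (extremal n d))
    ≡⟨ cong sum (List.map-++ S (replicate (n ℕ./ suc d) (suc d)) _) ⟩
  sum (map S (replicate (n ℕ./ suc d) (suc d)) ++ map S (replicate (n ℕ.% suc d) 1))
    ≡⟨ ℕ.sum-++ (map S (replicate (n ℕ./ suc d) (suc d))) _ ⟩
  sum (map S (replicate (n ℕ./ suc d) (suc d))) ℕ.+ sum (map S (replicate (n ℕ.% suc d) 1))
    ≡⟨ cong₂ (λ xs ys → sum xs ℕ.+ sum ys) (List.map-replicate S (n ℕ./ suc d) (suc d)) (List.map-replicate S (n ℕ.% suc d) 1) ⟩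
  sum (replicate (n ℕ./ suc d) (S (suc d))) ℕ.+ sum (replicate (n ℕ.% suc d) (S 1))
    ≡⟨ cong₂ ℕ._+_ (sum-replicate (n ℕ./ suc d) (S (suc d))) (sum-replicate (n ℕ.% suc d) (S 1)) ⟩
  n ℕ./ suc d ℕ.* S (suc d) ℕ.+ n ℕ.% suc d ℕ.* S 1
    ≡⟨ cong₂ ℕ._+_ (trans (cong (n ℕ./ suc d ℕ.*_) S[1+d]≡1) (ℕ.*-identityʳ _)) (no-ones d) ⟩
  n ℕ./ suc d ℕ.+ 0
    ≡⟨ ℕ.+-identityʳ _ ⟩
  n ℕ./ suc d
    ∎
  where
  open ≡-Reasoning
  S = oddMultiple (suc d)
  S[1+d]≡1 : S (suc d) ≡ 1
  S[1+d]≡1 rewrite [∣]-yes (ℕ.∣-refl {suc d}) | [∣]-large {2 ℕ.* suc d} {suc d} (ℕ.s≤s ℕ.z≤n) (n<2*n (ℕ.s≤s ℕ.z≤n)) = refl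
  -- the ones are absent when d = 0 and are not multiples of d + 1 otherwise
  no-ones : ∀ d → n ℕ.% suc d ℕ.* oddMultiple (suc d) 1 ≡ 0
  no-ones zero    rewrite ℕ.n%1≡0 n = refl
  no-ones (suc d) rewrite [∣]-large {suc (suc d)} {1} ℕ.≤-refl (ℕ.s≤s (ℕ.s≤s ℕ.z≤n)) = ℕ.*-zeroʳ (n ℕ.% suc (suc d))

expG : ℕ → ℕ → ℕ
expG n = exponent n (c n)

expH : ℕ → List ℕ → ℕ → ℕ
expH n λs = exponent n (λ i → divℕ n i ℕ.∸ mult λs i)

-- At e = 2(d+1) both exponents fall short of ∑ ⌊n/i⌋ [i/(d+1) odd]:
-- G's by ⌊n/(d+1)⌋, h_λ's by the number of parts that are odd multiples of d + 1.
expG-even : ∀ n d → expG n (2 ℕ.* suc d) ℕ.+ n ℕ./ suc d ≡ ∑ n (λ i → divℕ n i ℕ.* oddMultiple (suc d) i)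
expG-even n d = trans (cong (ℕ._+ n ℕ./ suc d) (exponent-even n (c n) (suc d))) (∑-c-oddMultiple n d)

expH-even : ∀ {n λs} d → IsPartition n λs →
            expH n λs (2 ℕ.* suc d) ℕ.+ sum (map (oddMultiple (suc d)) λs) ≡ ∑ n (λ i → divℕ n i ℕ.* oddMultiple (suc d) i)
expH-even {n} {λs} d partition =
  trans (cong (ℕ._+ sum (map (oddMultiple (suc d)) λs)) (exponent-even n (λ i → divℕ n i ℕ.∸ mult λs i) (suc d)))
        (∑-h-oddMultiple (suc d) partition)

expG≤expH : ∀ {n λs} e → 1 ℕ.≤ e → IsPartition n λs → expG n e ℕ.≤ expH n λs e
expG≤expH {n} {λs} e 1≤e partition with parity e
... | zero  , inj₁ refl = ⊥-elim (ℕ.<-irrefl refl 1≤e)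
... | suc d , inj₁ refl = ℕ.+-cancelʳ-≤ (n ℕ./ suc d) (expG n e) (expH n λs e) (begin
  expG n e ℕ.+ n ℕ./ suc d                                      ≡⟨ trans (expG-even n d) (sym (expH-even d partition)) ⟩
  expH n λs e ℕ.+ sum (map (oddMultiple (suc d)) λs)            ≤⟨ ℕ.+-monoʳ-≤ (expH n λs e) (oddParts≤ d partition) ⟩
  expH n λs e ℕ.+ n ℕ./ suc d                                   ∎)
  where open ℕ.≤-Reasoning
... | h     , inj₂ refl = ℕ.≤-reflexive (trans (exponent-odd n (c n) h) (sym (exponent-odd n (λ i → divℕ n i ℕ.∸ mult λs i) h)))

witness : ℕ → ℕ → List ℕ
witness n e with parity e
... | _     , inj₂ _ = extremal n 0
... | zero  , inj₁ _ = extremal n 0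
... | suc d , inj₁ _ = extremal n d

witness-IsPartition : ∀ n e → IsPartition n (witness n e)
witness-IsPartition n e with parity e
... | _     , inj₂ _ = extremal-IsPartition n 0
... | zero  , inj₁ _ = extremal-IsPartition n 0
... | suc d , inj₁ _ = extremal-IsPartition n d

expH-witness : ∀ n e → 1 ℕ.≤ e → expH n (witness n e) e ≡ expG n e
expH-witness n e 1≤e with parity e
... | h     , inj₂ refl = trans (exponent-odd n (λ i → divℕ n i ℕ.∸ mult (extremal n 0) i) h) (sym (exponent-odd n (c n) h))
... | zero  , inj₁ refl = ⊥-elim (ℕ.<-irrefl refl 1≤e)
... | suc d , inj₁ refl = ℕ.+-cancelʳ-≡ (n ℕ./ suc d) _ _ (begin
  expH n (extremal n d) e ℕ.+ n ℕ./ suc d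
    ≡⟨ cong (expH n (extremal n d) e ℕ.+_) (oddParts-extremal n d) ⟨
  expH n (extremal n d) e ℕ.+ sum (map (oddMultiple (suc d)) (extremal n d))
    ≡⟨ trans (expH-even d (extremal-IsPartition n d)) (sym (expG-even n d)) ⟩
  expG n e ℕ.+ n ℕ./ suc d
    ∎)
  where open ≡-Reasoning

-- Monicity

VanishesFrom : Poly → ℕ → Set
VanishesFrom f d = ∀ k → d ℕ.≤ k → coeff f k ≡ + 0

MonicOfDegree : Poly → ℕ → Set
MonicOfDegree f d = coeff f d ≡ + 1 × VanishesFrom f (suc d)

Monic-resp : ∀ {f g} → f ≋ g → Monic f → Monic g
Monic-resp f≋g (d , f_d≡1 , f-vanishes) = d , trans (sym (at f≋g d)) f_d≡1 , λ k d<k → trans (sym (at f≋g k)) (f-vanishes k d<k)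

MonicOfDegree-*ₚ : ∀ {f g a b} → MonicOfDegree f a → MonicOfDegree g b → MonicOfDegree (f *ₚ g) (a ℕ.+ b)
MonicOfDegree-*ₚ {[]}    {g} {a}     (() , _)
MonicOfDegree-*ₚ {x ∷ f} {g} {zero}  (x≡1 , f-vanishes) (g_b≡1 , g-vanishes) =
  trans (at x∷f*g≋g _) g_b≡1 , λ k b<k → trans (at x∷f*g≋g k) (g-vanishes k b<k)
  where
  x∷f*g≋g : ((x ∷ f) *ₚ g) ≋ g
  x∷f*g≋g = ≋-trans (+ₚ-cong (≋-trans (≡⇒≋ (cong (λ y → scaleₚ y g) x≡1)) (scaleₚ-identity g))
                             (≋-trans (shift-cong (*ₚ-zeroˡ {f} g (mk≋ λ k → f-vanishes (suc k) (ℕ.s≤s ℕ.z≤n)))) shift-[]))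
                    (+ₚ-identityʳ g)
MonicOfDegree-*ₚ {x ∷ f} {g} {suc a} {b} (f_a≡1 , f-vanishes) (g_b≡1 , g-vanishes) =
  trans (coeff-suc (a ℕ.+ b) (ℕ.s≤s (ℕ.m≤n+m b a))) (proj₁ IH) ,
  λ { (suc k) (ℕ.s≤s a+b<k) → trans (coeff-suc k (ℕ.<-trans (ℕ.s≤s (ℕ.m≤n+m b a)) (ℕ.s≤s a+b<k))) (proj₂ IH k a+b<k) }
  where
  IH : MonicOfDegree (f *ₚ g) (a ℕ.+ b)
  IH = MonicOfDegree-*ₚ {f} {g} (f_a≡1 , λ k a<k → f-vanishes (suc k) (ℕ.s≤s a<k)) (g_b≡1 , g-vanishes)
  -- above the degree of g only the shifted product contributes
  coeff-suc : ∀ k → b ℕ.< suc k → coeff ((x ∷ f) *ₚ g) (suc k) ≡ coeff (f *ₚ g) k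
  coeff-suc k b<1+k = trans (coeff-∷-*ₚ x f g (suc k))
    (trans (cong (ℤ._+ coeff (f *ₚ g) k) (trans (cong (x ℤ.*_) (g-vanishes (suc k) b<1+k)) (ℤ.*-zeroʳ x))) (ℤ.+-identityˡ _))

Monic-*ₚ : ∀ {f g} → Monic f → Monic g → Monic (f *ₚ g)
Monic-*ₚ {f} {g} (a , f-monic) (b , g-monic) = a ℕ.+ b , MonicOfDegree-*ₚ {f} {g} f-monic g-monic

Monic-oneₚ : Monic oneₚ
Monic-oneₚ = 0 , refl , λ { (suc k) _ → refl }

Monic-^ₚ : ∀ {f} k → Monic f → Monic (f ^ₚ k)
Monic-^ₚ zero    _       = Monic-oneₚ
Monic-^ₚ {f} (suc k) f-monic = Monic-*ₚ {f} {f ^ₚ k} f-monic (Monic-^ₚ {f} k f-monic)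

MonicOfDegree-shift : ∀ {a f d} → MonicOfDegree f d → MonicOfDegree (a ∷ f) (suc d)
MonicOfDegree-shift (f_d≡1 , f-vanishes) = f_d≡1 , λ { (suc k) (ℕ.s≤s d<k) → f-vanishes k d<k }

MonicOfDegree-xpow : ∀ i → MonicOfDegree (xpow i) i
MonicOfDegree-xpow zero    = refl , λ { (suc k) _ → refl }
MonicOfDegree-xpow (suc i) = MonicOfDegree-shift (MonicOfDegree-xpow i)

Monic-onePlusX : ∀ i → 1 ℕ.≤ i → Monic (onePlusX i)
Monic-onePlusX (suc i) _ = suc i , MonicOfDegree-shift (MonicOfDegree-xpow i)

Monic-∏ : ∀ {P} n a → AllUpTo n (Monic ∘ P) → Monic (∏ P n a)
Monic-∏ zero    a _       = Monic-oneₚ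
Monic-∏ {P} (suc n) a P-monic =
  Monic-*ₚ {∏ P n a} (Monic-∏ {P} n a (AllUpTo-init P-monic)) (Monic-^ₚ {P (suc n)} (a (suc n)) (AllUpTo-last P-monic))

prodₚ-++ : ∀ fs gs → prodₚ (fs ++ gs) ≋ (prodₚ fs *ₚ prodₚ gs)
prodₚ-++ []       gs = ≋-sym (*ₚ-identityˡ (prodₚ gs))
prodₚ-++ (f ∷ fs) gs = ≋-trans (*ₚ-congʳ f (prodₚ-++ fs gs)) (≋-sym (*ₚ-assoc f (prodₚ fs) (prodₚ gs)))

oneTo-suc : ∀ n → oneTo (suc n) ≡ oneTo n ++ (suc n ∷ [])
oneTo-suc n = trans (cong (map suc) (sym (List.upTo-∷ʳ n))) (List.map-++ suc (upTo n) (n ∷ []))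

prodₚ-oneTo : ∀ P n a → prodₚ (map (λ i → P i ^ₚ a i) (oneTo n)) ≋ ∏ P n a
prodₚ-oneTo P zero    a = ≋-refl
prodₚ-oneTo P (suc n) a = begin
  prodₚ (map F (oneTo (suc n)))                  ≡⟨ cong (prodₚ ∘ map F) (oneTo-suc n) ⟩
  prodₚ (map F (oneTo n ++ (suc n ∷ [])))           ≡⟨ cong prodₚ (List.map-++ F (oneTo n) (suc n ∷ [])) ⟩
  prodₚ (map F (oneTo n) ++ (F (suc n) ∷ []))       ≈⟨ prodₚ-++ (map F (oneTo n)) (F (suc n) ∷ []) ⟩
  prodₚ (map F (oneTo n)) *ₚ (F (suc n) *ₚ oneₚ)  ≈⟨ *ₚ-cong (prodₚ-oneTo P n a) (*ₚ-identityʳ (F (suc n))) ⟩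
  ∏ P n a *ₚ F (suc n)                           ∎
  where
  open ≋-Reasoning
  F = λ i → P i ^ₚ a i

∏-∏ : ∀ {P Φ : ℕ → Poly} {L} {δ : ℕ → ℕ → ℕ} n a → AllUpTo n (λ i → P i ≋ ∏ Φ L (δ i)) →
      ∏ P n a ≋ ∏ Φ L (λ e → ∑ n (λ i → a i ℕ.* δ i e))
∏-∏ {Φ = Φ} {L} zero    a _        = ≋-sym (∏-zero Φ L λ _ _ _ → refl)
∏-∏ {P} {Φ} {L} {δ} (suc n) a P≋∏Φ = begin
  ∏ P n a *ₚ (P (suc n) ^ₚ a (suc n))
    ≈⟨ *ₚ-cong (∏-∏ {P} {Φ} {L} {δ} n a (AllUpTo-init P≋∏Φ)) (^ₚ-cong (a (suc n)) (AllUpTo-last P≋∏Φ)) ⟩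
  ∏ Φ L (λ e → ∑ n (λ i → a i ℕ.* δ i e)) *ₚ (∏ Φ L (δ (suc n)) ^ₚ a (suc n))
    ≈⟨ *ₚ-congʳ (∏ Φ L _) (∏-^ₚ Φ L (δ (suc n)) (a (suc n))) ⟩
  ∏ Φ L (λ e → ∑ n (λ i → a i ℕ.* δ i e)) *ₚ ∏ Φ L (λ e → a (suc n) ℕ.* δ (suc n) e)
    ≈⟨ ∏-+ Φ L _ _ ⟩
  ∏ Φ L (λ e → ∑ (suc n) (λ i → a i ℕ.* δ i e))
    ∎
  where open ≋-Reasoning

oneMinusX-*2 : ∀ i → oneMinusX (2 ℕ.* i) ≋ (oneMinusX i *ₚ onePlusX i)
oneMinusX-*2 i = ≋-trans
  (+ₚ-cong ≋-refl (negₚ-cong (≋-trans (≡⇒≋ (cong (λ k → xpow (i ℕ.+ k)) (ℕ.+-identityʳ i))) (≋-sym (xpow-+ i i)))))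
  (difference-of-squares (xpow i))
  where
  difference-of-squares : ∀ x → (oneₚ +ₚ negₚ (x *ₚ x)) ≋ ((oneₚ +ₚ negₚ x) *ₚ (oneₚ +ₚ x))
  difference-of-squares = solve-∀ polyRing

onePlusX-factorisation : ∀ {L Φ} → CyclotomicFamily L Φ → ∀ i → 1 ℕ.≤ i → 2 ℕ.* i ℕ.≤ L
                       → onePlusX i ≋ ∏ Φ L (onePlusX-exponent i)
onePlusX-factorisation {L} {Φ} family i 1≤i 2i≤L = *ₚ-cancelˡ (UnitConstant-oneMinusX i 1≤i) (begin
  oneMinusX i *ₚ onePlusX i                          ≈⟨ oneMinusX-*2 i ⟨
  oneMinusX (2 ℕ.* i)                                ≈⟨ factorisation (2 ℕ.* i) (ℕ.≤-trans 1≤i (ℕ.m≤m+n i _)) 2i≤L ⟩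
  ∏ Φ L [_∣ 2 ℕ.* i ]                                ≈⟨ ∏-cong Φ L (λ d _ _ → ℕ.m+[n∸m]≡n ([∣]-mono d (ℕ.n∣m*n 2))) ⟨
  ∏ Φ L (λ d → [ d ∣ i ] ℕ.+ onePlusX-exponent i d)  ≈⟨ ∏-+ Φ L _ _ ⟨
  ∏ Φ L [_∣ i ] *ₚ ∏ Φ L (onePlusX-exponent i)       ≈⟨ *ₚ-congˡ _ (factorisation i 1≤i (ℕ.≤-trans (ℕ.m≤m+n i _) 2i≤L)) ⟨
  oneMinusX i *ₚ ∏ Φ L (onePlusX-exponent i)         ∎)
  where
  open ≋-Reasoning
  open CyclotomicFamily family

UnitConstant-resp : ∀ {f g} → f ≋ g → UnitConstant f → UnitConstant g
UnitConstant-resp f≋g (unitConstant u f₀u≡1) = unitConstant u (trans (cong (ℤ._* u) (sym (at f≋g 0))) f₀u≡1)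

UnitConstant-onePlusX : ∀ i → 1 ℕ.≤ i → UnitConstant (onePlusX i)
UnitConstant-onePlusX (suc i) _ = unitConstant (+ 1) refl

-- The gcd of the h_λ

∣⇒∣ₚ : ∀ {d f} → d ∣ f → d ∣ₚ f
∣⇒∣ₚ (divides q dq≋f) = q , at dq≋f

∣ₚ⇒∣ : ∀ {d f} → d ∣ₚ f → d ∣ f
∣ₚ⇒∣ (q , dq≈f) = divides q (mk≋ dq≈f)

module _ (n : ℕ) where

  private
    L = 2 ℕ.* n
    Φ = proj₁ (cyclotomicFamily L)
    family = proj₂ (cyclotomicFamily L)

  prodₚ-onePlusX≋∏Φ : ∀ a → prodₚ (map (λ i → onePlusX i ^ₚ a i) (oneTo n)) ≋ ∏ Φ L (exponent n a)
  prodₚ-onePlusX≋∏Φ a = ≋-trans (prodₚ-oneTo onePlusX n a)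
    (∏-∏ {onePlusX} {Φ} {L} {onePlusX-exponent} n a λ i 1≤i i≤n → onePlusX-factorisation family i 1≤i (ℕ.*-monoʳ-≤ 2 i≤n))

  Gformula≋∏Φ : Gformula n ≋ ∏ Φ L (expG n)
  Gformula≋∏Φ = prodₚ-onePlusX≋∏Φ (c n)

  h≋∏Φ : ∀ λs → h n λs ≋ ∏ Φ L (expH n λs)
  h≋∏Φ λs = prodₚ-onePlusX≋∏Φ (λ i → divℕ n i ℕ.∸ mult λs i)

  Monic-Gformula : Monic (Gformula n)
  Monic-Gformula = Monic-resp (≋-sym (prodₚ-oneTo onePlusX n (c n)))
    (Monic-∏ {onePlusX} n (c n) λ i 1≤i _ → Monic-onePlusX i 1≤i)

  UnitConstant-h : ∀ λs → UnitConstant (h n λs)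
  UnitConstant-h λs = UnitConstant-resp (≋-sym (prodₚ-oneTo onePlusX n (λ i → divℕ n i ℕ.∸ mult λs i)))
    (UnitConstant-∏ onePlusX n (λ i → divℕ n i ℕ.∸ mult λs i) λ i 1≤i _ → UnitConstant-onePlusX i 1≤i)

  Gformula-∣-h : ∀ λs → IsPartition n λs → Gformula n ∣ₚ h n λs
  Gformula-∣-h λs partition =
    ∣⇒∣ₚ (∣-resp (≋-sym Gformula≋∏Φ) (≋-sym (h≋∏Φ λs)) (∏-∣ Φ L λ e 1≤e _ → expG≤expH e 1≤e partition))

  ∣-Gformula : 1 ℕ.≤ n → ∀ e → (∀ λs → IsPartition n λs → e ∣ₚ h n λs) → e ∣ₚ Gformula n
  ∣-Gformula 1≤n e e∣h = ∣⇒∣ₚ (∣-resp ≋-refl (≋-sym Gformula≋∏Φ) (∣ℚ⇒∣ unit-e e∣ℚ∏Φ^expG))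
    where
    e∣h′ : ∀ λs → IsPartition n λs → e ∣ h n λs
    e∣h′ λs partition = ∣ₚ⇒∣ (e∣h λs partition)
    unit-e : UnitConstant e
    unit-e = ∣-UnitConstant (e∣h′ (extremal n 0) (extremal-IsPartition n 0)) (UnitConstant-h (extremal n 0))
    e∣ℚ∏Φ^expG : e ∣ℚ ∏ Φ L (expG n)
    e∣ℚ∏Φ^expG = GcdCriterion.e∣ℚ∏g family (expG n) (expH n ∘ witness n) (λ j 1≤j _ → expH-witness n j 1≤j)
      (λ j _ _ → ∣⇒∣ℚ (∣-resp ≋-refl (h≋∏Φ (witness n j)) (e∣h′ (witness n j) (witness-IsPartition n j))))
      (ℕ.≤-trans 1≤n (ℕ.m≤m+n n _))

proposition3p5 : (n : ℕ) → 1 ≤ n →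
    IsMonicGCD (IsPartition n) (h n) (Gformula n)
    × (∀ i → 1 ≤ i → i ≤ divℕ n 3 → 0 < c n i)
    × (∀ i j → 1 ≤ i → i ≤ j → j ≤ n → c n j ≤ c n i)
proposition3p5 n 1≤n = (Monic-Gformula n , Gformula-∣-h n , ∣-Gformula n 1≤n) , c-pos n , c-mono n
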